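{- Let $q$ be a prime power and $1\le k\le n-1$. Let $\mathcal{A}_{k,n}$ be the set of $(n-k)$-tuples $(f_1,\dots,f_{n-k})$ of functions $f_j:(\mathbb{F}_q)^k\to\mathbb{F}_q$, each function being identified with its unique representing polynomial in $\mathbb{F}_q[x_1,\dots,x_k]$ of degree less than $q$ in each variable. Then the assignment $$(f_1,\dots,f_{n-k})\longmapsto G=E_q[X]\cup\{z_1-f_1,\dots,z_{n-k}-f_{n-k}\}$$ gives a bijection between $\mathcal{A}_{k,n}$ and the class $\mathcal{C}(n,k,q)$ of systematic $(n,k,q)$ codes, where a code corresponds to the set $G$ that is the reduced Gröbner basis of its vanishing ideal in $\mathbb{F}_q[x_1,\dots,x_k,z_1,\dots,z_{n-k}]$ with respect to the lexicographic order $x_1<\dots<x_k<z_1<\dots<z_{n-k}$ (equivalently, the code whose set of points is the zero set of $G$).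
   Context: An $(n,k,q)$ code is the image $C=\mathrm{Im}(\phi)$ of an injective map $\phi:(\mathbb{F}_q)^k\to(\mathbb{F}_q)^n$; it is systematic if the first $k$ coordinates of $\phi(v)$ equal $v$ for every $v$. $\mathcal{C}(n,k,q)$ denotes the class of systematic $(n,k,q)$ codes. $E_q[X]=\{x_1^q-x_1,\dots,x_k^q-x_k\}$. -}

module Defs where

open import Level using (Level; _⊔_) renaming (suc to lsuc)
open import Data.Nat as ℕ using (ℕ; zero; suc; _<_; _≤_)
open import Data.Nat.Primality using (Prime)
open import Data.Fin using (Fin; _↑ˡ_; _↑ʳ_)
open import Data.Vec as Vec using (Vec; []; _∷_; _++_; replicate; take; _[_]≔_; zipWith; foldr; toList; reverse)
open import Data.Vec.Properties using (≡-dec)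
open import Data.List as List using (List; _∷_; [])
open import Data.List.Membership.Propositional using (_∈_)
open import Data.Product using (Σ; ∃; ∃-syntax; _×_; _,_)
open import Data.Sum using (_⊎_)
open import Relation.Nullary using (¬_; yes; no)
open import Relation.Binary.PropositionalEquality using (_≡_; _≢_)
open import Algebra.Structures using (IsCommutativeRing)
open import Function.Bundles using (_↔_; _⇔_)
open import Function.Definitions using (Injective)
open import Data.Vec.Relation.Binary.Pointwise.Inductive using (Pointwise)
open import Data.Vec.Relation.Unary.All using (All)
open import Data.List.Base using (length; lookup)

record Field (c : Level) : Set (lsuc c) where
  infixl 7 _*_
  infixl 6 _+_
  field
    Carrier : Set c
    _+_ _*_ : Carrier → Carrier → Carrier
    -_      : Carrier → Carrier
    0# 1#   : Carrier
    isCommutativeRing : IsCommutativeRing _≡_ _+_ _*_ -_ 0# 1#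
    0≢1     : 0# ≢ 1#
    inverse : ∀ x → x ≢ 0# → ∃[ y ] (x * y ≡ 1#)

IsPrimePower : ℕ → Set
IsPrimePower q = ∃[ p ] ∃[ e ] (Prime p × q ≡ p ℕ.^ suc e)

HasSize : ∀ {c} → Field c → ℕ → Set c
HasSize K q = Fin q ↔ Field.Carrier K

-- Multivariate polynomials over K in N variables, as finite term lists
-- (coefficient, exponent vector); repeated monomials are summed.

module Poly {c} (K : Field c) where
  open Field K

  Mon : ℕ → Set
  Mon N = Vec ℕ N

  Pol : ℕ → Set c
  Pol N = List (Carrier × Mon N)

  coeff : ∀ {N} → Pol N → Mon N → Carrier
  coeff [] m = 0#
  coeff ((a , e) ∷ p) m with ≡-dec ℕ._≟_ e m
  ... | yes _ = a + coeff p m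
  ... | no  _ = coeff p m

  _^_ : Carrier → ℕ → Carrier
  x ^ zero  = 1#
  x ^ suc n = x * (x ^ n)

  evalMon : ∀ {N} → Mon N → Vec Carrier N → Carrier
  evalMon e x = foldr _ _*_ 1# (zipWith (λ xi ei → xi ^ ei) x e)

  eval : ∀ {N} → Pol N → Vec Carrier N → Carrier
  eval [] x = 0#
  eval ((a , e) ∷ p) x = a * evalMon e x + eval p x

  _∣ₘ_ : ∀ {N} → Mon N → Mon N → Set
  e ∣ₘ f = Pointwise _≤_ e f

  data LexLt : List ℕ → List ℕ → Set where
    here  : ∀ {a b xs ys} → a < b → LexLt (a ∷ xs) (b ∷ ys)
    there : ∀ {a xs ys} → LexLt xs ys → LexLt (a ∷ xs) (a ∷ ys)

  -- Lex order on monomials with variables ordered by index: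
  -- var 0 < var 1 < ... < var (N-1)  (so the last variable is compared first).
  -- With variables x_1..x_k, z_1..z_m in this order this is the lex order
  -- x_1 < ... < x_k < z_1 < ... < z_m of the paper.
  _<lex_ : ∀ {N} → Mon N → Mon N → Set
  e <lex f = LexLt (toList (reverse e)) (toList (reverse f))

  IsLM : ∀ {N} → Pol N → Mon N → Set c
  IsLM p m = coeff p m ≢ 0# × (∀ m′ → coeff p m′ ≢ 0# → m′ ≡ m ⊎ m′ <lex m)

  IsReducedGB : ∀ {N} → (Pol N → Set c) → List (Pol N) → Set c
  IsReducedGB {N} I G =
      (∀ {g} → g ∈ G → I g)
    × (∀ f mf → I f → IsLM f mf → ∃[ g ] ∃[ mg ] (g ∈ G × IsLM g mg × mg ∣ₘ mf))
    × (∀ {g} → g ∈ G → ∃[ mg ] (IsLM g mg × coeff g mg ≡ 1#))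
    × (∀ (i j : Fin (length G)) → i ≢ j → ∀ mj e →
         IsLM (lookup G j) mj → coeff (lookup G i) e ≢ 0# → ¬ (mj ∣ₘ e))

  Vanishing : ∀ {N} → (Vec Carrier N → Set c) → Pol N → Set c
  Vanishing C f = ∀ y → C y → eval f y ≡ 0#

  ZeroSet : ∀ {N} → List (Pol N) → Vec Carrier N → Set c
  ZeroSet G y = ∀ {g} → g ∈ G → eval g y ≡ 0#

  IsSystematicCode : ∀ k m → (Vec Carrier (k ℕ.+ m) → Set c) → Set c
  IsSystematicCode k m C =
    ∃[ φ ] (Injective _≡_ _≡_ φ × (∀ v → take k (φ v) ≡ v)
            × (∀ y → C y ⇔ (∃[ v ] φ v ≡ y)))

  DegLt : ∀ {k} → ℕ → Pol k → Set c
  DegLt q P = ∀ e → coeff P e ≢ 0# → All (_< q) e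

  Represents : ∀ {k} → Pol k → (Vec Carrier k → Carrier) → Set c
  Represents P f = ∀ x → eval P x ≡ f x

  unitMon : ∀ {N} → Fin N → ℕ → Mon N
  unitMon i a = replicate _ 0 [ i ]≔ a

  xPoly : ∀ k m → ℕ → Fin k → Pol (k ℕ.+ m)
  xPoly k m q i = (1# , unitMon (i ↑ˡ m) q) ∷ (- 1# , unitMon (i ↑ˡ m) 1) ∷ []

  zPoly : ∀ k m → Fin m → Pol k → Pol (k ℕ.+ m)
  zPoly k m j P = (1# , unitMon (k ↑ʳ j) 1) ∷ List.map neg P
    where
    neg : Carrier × Mon k → Carrier × Mon (k ℕ.+ m)
    neg (a , e) = (- a , e ++ replicate m 0)

  GSet : ∀ k m → ℕ → (Fin m → Pol k) → List (Pol (k ℕ.+ m))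
  GSet k m q P = List.tabulate (xPoly k m q) List.++ List.tabulate (λ j → zPoly k m j (P j))

module Submission where

-- Plan.  (1) Fermat: a ^ q ≡ a in the q-element field.  (2) Reduced
-- representatives exist (Lagrange interpolation with δₐ(t) = 1 - (t-a)^(q-1))
-- and are unique (a reduced polynomial vanishing on K^k is zero: induction on
-- the number of variables, using that a univariate polynomial with fewer than
-- q coefficients and q roots is zero).  (3) The zero set of G is the graph
-- {(x, F(x))}, hence a systematic code, and a systematic code with redundancy
-- functions F is exactly the zero set of the G built from F; this gives
-- injectivity and surjectivity.  (4) The Gröbner basis property: the leading
-- monomials of G are x_i^q and z_j, the generators are monic and mutually
-- reduced, and a polynomial vanishing on the graph whose leading monomial were
-- divisible by none of them would, after dropping z and reducing exponents,
-- give a nonzero reduced polynomial vanishing on K^k, contradicting (2).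
-- Polynomials are term lists, so coefficients are compared through linear
-- functionals of the term list, which only depend on the coefficient function.

open import Defs
open import Data.Nat using (ℕ; _≤_; zero; suc)
import Data.Nat as ℕ
import Data.Nat.Properties as ℕP
import Data.Nat.DivMod as DM
open import Data.Nat.Primality using (¬prime[0]; ¬prime[1])
open import Data.Fin using (Fin)
import Data.Fin as F
import Data.Fin.Properties as FP
open import Data.Fin.Permutation using (Permutation; _⟨$⟩ʳ_)
open import Data.Vec using (Vec; []; _∷_)
import Data.Vec as V
import Data.Vec.Properties as VP
open import Data.Vec.Functional using (removeAt)
open import Data.Vec.Relation.Unary.All using (All; []; _∷_)
import Data.Vec.Relation.Unary.All.Properties as VAP
import Data.Vec.Relation.Binary.Pointwise.Inductive as VPW
open import Data.List using (List; []; _∷_)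
import Data.List as L
import Data.List.Properties as LP
open import Data.List.Relation.Unary.All as LA using () renaming ([] to []ᴸ; _∷_ to _∷ᴸ_)
import Data.List.Relation.Unary.All.Properties as LAP
import Data.List.Relation.Binary.Pointwise as LPW
open import Data.List.Membership.Propositional using (_∈_)
import Data.List.Membership.Propositional.Properties as MP
open import Data.Product using (∃; ∃-syntax; Σ-syntax; _×_; _,_; proj₁; proj₂)
open import Data.Sum using (_⊎_; inj₁; inj₂; [_,_])
import Data.Sum as Sum
import Data.Sum.Properties as SumP
open import Data.Empty using (⊥; ⊥-elim)
open import Relation.Nullary using (¬_; yes; no; Dec)
open import Relation.Binary.Definitions using (DecidableEquality)
open import Relation.Binary.PropositionalEquality
  using (_≡_; _≢_; refl; sym; trans; cong; cong₂; subst; subst₂; module ≡-Reasoning)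
open import Function.Bundles using (_⇔_; mk⇔; Equivalence; _↔_; Inverse; mk↔ₛ′)
open import Algebra.Bundles using (CommutativeRing; CommutativeMonoid)
import Algebra.Properties.Ring as RingProperties
import Algebra.Properties.CommutativeSemigroup as CommutativeSemigroupProperties
import Algebra.Properties.CommutativeMonoid.Sum as CommutativeMonoidSum

module FieldArithmetic {c} (K : Field c) where
  open Field K
  open Poly K using (_^_)
  open ≡-Reasoning

  ring : CommutativeRing c c
  ring = record { isCommutativeRing = isCommutativeRing }

  open CommutativeRing ring public
    using ( _-_; +-assoc; *-assoc; *-comm; +-identityˡ; +-identityʳ
          ; *-identityˡ; *-identityʳ; distribˡ; distribʳ; -‿inverseˡ; -‿inverseʳ
          ; zeroˡ; zeroʳ)
  open RingProperties (CommutativeRing.ring ring) public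
    using (-‿distribˡ-*; x[y-z]≈xy-xz; -‿+-comm)
    renaming (-0#≈0# to -0#≡0#; x∙y⁻¹≈ε⇒x≈y to x-y≡0⇒x≡y)

  module +-Rearrange = CommutativeSemigroupProperties (CommutativeRing.+-commutativeSemigroup ring)
  module *-Rearrange = CommutativeSemigroupProperties
    (CommutativeMonoid.commutativeSemigroup (CommutativeRing.*-commutativeMonoid ring))

  x-x≡0 : ∀ x → x - x ≡ 0#
  x-x≡0 = -‿inverseʳ

  -*-comm : ∀ a b → - a * b ≡ - (a * b)
  -*-comm a b = sym (-‿distribˡ-* a b)

  1#≢0# : 1# ≢ 0#
  1#≢0# eq = 0≢1 (sym eq)

  noZeroDivisors : ∀ a b → a * b ≡ 0# → a ≢ 0# → b ≡ 0#
  noZeroDivisors a b ab≡0 a≢0 with inverse a a≢0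
  ... | a⁻¹ , aa⁻¹≡1 = begin
    b               ≡⟨ sym (*-identityˡ b) ⟩
    1# * b          ≡⟨ cong (_* b) (sym aa⁻¹≡1) ⟩
    a * a⁻¹ * b     ≡⟨ *-Rearrange.xy∙z≈y∙xz a a⁻¹ b ⟩
    a⁻¹ * (a * b)   ≡⟨ cong (a⁻¹ *_) ab≡0 ⟩
    a⁻¹ * 0#        ≡⟨ zeroʳ a⁻¹ ⟩
    0#              ∎

  *-≢0 : ∀ {a b} → a ≢ 0# → b ≢ 0# → a * b ≢ 0#
  *-≢0 {a} {b} a≢0 b≢0 ab≡0 = b≢0 (noZeroDivisors a b ab≡0 a≢0)

  fixes⇒≡1 : ∀ x g → x * g ≡ g → g ≢ 0# → x ≡ 1#
  fixes⇒≡1 x g xg≡g g≢0 = x-y≡0⇒x≡y x 1# (noZeroDivisors g (x - 1#) g[x-1]≡0 g≢0)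
    where
    g[x-1]≡0 : g * (x - 1#) ≡ 0#
    g[x-1]≡0 = begin
      g * (x - 1#)      ≡⟨ x[y-z]≈xy-xz g x 1# ⟩
      g * x - g * 1#    ≡⟨ cong₂ _-_ (trans (*-comm g x) xg≡g) (*-identityʳ g) ⟩
      g - g             ≡⟨ x-x≡0 g ⟩
      0#                ∎

  ^-+ : ∀ t d e → t ^ (d ℕ.+ e) ≡ t ^ d * t ^ e
  ^-+ t zero    e = sym (*-identityˡ _)
  ^-+ t (suc d) e = trans (cong (t *_) (^-+ t d e)) (sym (*-assoc t (t ^ d) (t ^ e)))

-- Polynomials are lists of terms, so a polynomial is determined by its
-- coefficient function only up to reordering and cancellation.  Every
-- "linear" evaluation of a polynomial, lin w p = Σ aᵢ w(eᵢ), therefore depends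
-- only on the values of w on the support {e | coeff p e ≢ 0}; this is the
-- basic tool for transferring statements about coefficients to evaluations.
module LinearFunctionals {c} (K : Field c) where
  open Field K
  open Poly K
  open FieldArithmetic K
  open ≡-Reasoning

  _≟ₘ_ : ∀ {N} → DecidableEquality (Mon N)
  _≟ₘ_ = VP.≡-dec ℕ._≟_

  coeff-head : ∀ {N} a (e : Mon N) p → coeff ((a , e) ∷ p) e ≡ a + coeff p e
  coeff-head a e p with e ≟ₘ e
  ... | yes _  = refl
  ... | no e≢e = ⊥-elim (e≢e refl)

  coeff-skip : ∀ {N} a (e e′ : Mon N) p → e ≢ e′ → coeff ((a , e) ∷ p) e′ ≡ coeff p e′
  coeff-skip a e e′ p e≢e′ with e ≟ₘ e′
  ... | yes e≡e′ = ⊥-elim (e≢e′ e≡e′)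
  ... | no _     = refl

  δₘ : ∀ {N} → Mon N → Mon N → Carrier
  δₘ e e′ with e ≟ₘ e′
  ... | yes _ = 1#
  ... | no _  = 0#

  δₘ-≡ : ∀ {N} (e : Mon N) → δₘ e e ≡ 1#
  δₘ-≡ e with e ≟ₘ e
  ... | yes _  = refl
  ... | no e≢e = ⊥-elim (e≢e refl)

  δₘ-≢ : ∀ {N} {e e′ : Mon N} → e ≢ e′ → δₘ e e′ ≡ 0#
  δₘ-≢ {e = e} {e′} e≢e′ with e ≟ₘ e′
  ... | yes e≡e′ = ⊥-elim (e≢e′ e≡e′)
  ... | no _     = refl

  lin : ∀ {N} → (Mon N → Carrier) → Pol N → Carrier
  lin w []            = 0#
  lin w ((a , e) ∷ p) = a * w e + lin w p

  eval≡lin : ∀ {N} (p : Pol N) x → eval p x ≡ lin (λ e → evalMon e x) p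
  eval≡lin []            x = refl
  eval≡lin ((a , e) ∷ p) x = cong (a * evalMon e x +_) (eval≡lin p x)

  remove : ∀ {N} → Mon N → Pol N → Pol N
  remove e₀ [] = []
  remove e₀ ((a , e) ∷ p) with e ≟ₘ e₀
  ... | yes _ = remove e₀ p
  ... | no _  = (a , e) ∷ remove e₀ p

  coeff-remove-≡ : ∀ {N} (e₀ : Mon N) p → coeff (remove e₀ p) e₀ ≡ 0#
  coeff-remove-≡ e₀ [] = refl
  coeff-remove-≡ e₀ ((a , e) ∷ p) with e ≟ₘ e₀
  ... | yes _   = coeff-remove-≡ e₀ p
  ... | no e≢e₀ = trans (coeff-skip a e e₀ _ e≢e₀) (coeff-remove-≡ e₀ p)

  coeff-remove-≢ : ∀ {N} (e₀ e′ : Mon N) p → e′ ≢ e₀ → coeff (remove e₀ p) e′ ≡ coeff p e′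
  coeff-remove-≢ e₀ e′ [] _ = refl
  coeff-remove-≢ e₀ e′ ((a , e) ∷ p) e′≢e₀ with e ≟ₘ e₀ | e ≟ₘ e′
  ... | yes refl | yes refl = ⊥-elim (e′≢e₀ refl)
  ... | yes refl | no _     = coeff-remove-≢ e₀ e′ p e′≢e₀
  ... | no _     | yes refl = trans (coeff-head a e _) (cong (a +_) (coeff-remove-≢ e₀ e′ p e′≢e₀))
  ... | no _     | no e≢e′  = trans (coeff-skip a e e′ _ e≢e′) (coeff-remove-≢ e₀ e′ p e′≢e₀)

  length-remove : ∀ {N} (e₀ : Mon N) p → L.length (remove e₀ p) ≤ L.length p
  length-remove e₀ [] = ℕ.z≤n
  length-remove e₀ ((a , e) ∷ p) with e ≟ₘ e₀
  ... | yes _ = ℕP.m≤n⇒m≤1+n (length-remove e₀ p)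
  ... | no _  = ℕ.s≤s (length-remove e₀ p)

  length-remove-head : ∀ {N} (e₀ : Mon N) a p → L.length (remove e₀ ((a , e₀) ∷ p)) ℕ.< suc (L.length p)
  length-remove-head e₀ a p with e₀ ≟ₘ e₀
  ... | yes _   = ℕ.s≤s (length-remove e₀ p)
  ... | no e≢e  = ⊥-elim (e≢e refl)

  lin-split : ∀ {N} (w : Mon N → Carrier) (e₀ : Mon N) p →
              lin w p ≡ coeff p e₀ * w e₀ + lin w (remove e₀ p)
  lin-split w e₀ [] = sym (trans (cong (_+ 0#) (zeroˡ (w e₀))) (+-identityʳ 0#))
  lin-split w e₀ ((a , e) ∷ p) with e ≟ₘ e₀
  ... | yes refl = begin
      a * w e + lin w p                                 ≡⟨ cong (a * w e +_) (lin-split w e p) ⟩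
      a * w e + (coeff p e * w e + lin w (remove e p))  ≡⟨ sym (+-assoc _ _ _) ⟩
      a * w e + coeff p e * w e + lin w (remove e p)    ≡⟨ cong (_+ lin w (remove e p)) (sym (distribʳ (w e) a _)) ⟩
      (a + coeff p e) * w e + lin w (remove e p)        ∎
  ... | no _ = begin
      a * w e + lin w p                                     ≡⟨ cong (a * w e +_) (lin-split w e₀ p) ⟩
      a * w e + (coeff p e₀ * w e₀ + lin w (remove e₀ p))   ≡⟨ +-Rearrange.x∙yz≈y∙xz _ _ _ ⟩
      coeff p e₀ * w e₀ + (a * w e + lin w (remove e₀ p))   ∎

  lin-cong-support : ∀ {N} (w w′ : Mon N → Carrier) (p : Pol N) →
                     (∀ e → coeff p e ≡ 0# ⊎ w e ≡ w′ e) → lin w p ≡ lin w′ p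
  lin-cong-support w w′ p = go (L.length p) p ℕP.≤-refl
    where
    go : ∀ n p → L.length p ≤ n → (∀ e → coeff p e ≡ 0# ⊎ w e ≡ w′ e) → lin w p ≡ lin w′ p
    go n [] _ _ = refl
    go (suc n) ((a , e₀) ∷ p) (ℕ.s≤s len≤n) agree = begin
        lin w P                                    ≡⟨ lin-split w e₀ P ⟩
        coeff P e₀ * w e₀ + lin w (remove e₀ P)    ≡⟨ cong₂ _+_ head-term rest ⟩
        coeff P e₀ * w′ e₀ + lin w′ (remove e₀ P)  ≡⟨ sym (lin-split w′ e₀ P) ⟩
        lin w′ P                                   ∎
      where
      P = (a , e₀) ∷ p
      head-term : coeff P e₀ * w e₀ ≡ coeff P e₀ * w′ e₀
      head-term with agree e₀
      ... | inj₁ c≡0  = trans (cong (_* w e₀) c≡0) (trans (zeroˡ _) (sym (trans (cong (_* w′ e₀) c≡0) (zeroˡ _))))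
      ... | inj₂ w≡w′ = cong (coeff P e₀ *_) w≡w′
      agree′ : ∀ e → coeff (remove e₀ P) e ≡ 0# ⊎ w e ≡ w′ e
      agree′ e with e ≟ₘ e₀
      ... | yes refl = inj₁ (coeff-remove-≡ e₀ P)
      ... | no e≢e₀ with agree e
      ...   | inj₁ c≡0  = inj₁ (trans (coeff-remove-≢ e₀ e P e≢e₀) c≡0)
      ...   | inj₂ w≡w′ = inj₂ w≡w′
      rest : lin w (remove e₀ P) ≡ lin w′ (remove e₀ P)
      rest = go n (remove e₀ P) (ℕP.≤-trans (ℕP.<⇒≤pred (length-remove-head e₀ a p)) len≤n) agree′

  lin-zero : ∀ {N} (p : Pol N) → lin (λ _ → 0#) p ≡ 0#
  lin-zero []            = refl
  lin-zero ((a , e) ∷ p) = trans (cong₂ _+_ (zeroʳ a) (lin-zero p)) (+-identityʳ 0#)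

  lin-affine : ∀ {N} (w₁ w₂ : Mon N → Carrier) t p →
               lin (λ e → w₁ e + t * w₂ e) p ≡ lin w₁ p + t * lin w₂ p
  lin-affine w₁ w₂ t [] = sym (trans (cong (0# +_) (zeroʳ t)) (+-identityʳ 0#))
  lin-affine w₁ w₂ t ((a , e) ∷ p) = begin
    a * (w₁ e + t * w₂ e) + lin (λ e → w₁ e + t * w₂ e) p
      ≡⟨ cong₂ _+_ (distribˡ a (w₁ e) (t * w₂ e)) (lin-affine w₁ w₂ t p) ⟩
    (a * w₁ e + a * (t * w₂ e)) + (lin w₁ p + t * lin w₂ p)
      ≡⟨ cong (λ z → (a * w₁ e + z) + (lin w₁ p + t * lin w₂ p)) (*-Rearrange.x∙yz≈y∙xz a t (w₂ e)) ⟩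
    (a * w₁ e + t * (a * w₂ e)) + (lin w₁ p + t * lin w₂ p)
      ≡⟨ +-Rearrange.interchange _ _ _ _ ⟩
    (a * w₁ e + lin w₁ p) + (t * (a * w₂ e) + t * lin w₂ p)
      ≡⟨ cong ((a * w₁ e + lin w₁ p) +_) (sym (distribˡ t _ _)) ⟩
    (a * w₁ e + lin w₁ p) + t * (a * w₂ e + lin w₂ p) ∎

  lin-++ : ∀ {N} w (p p′ : Pol N) → lin w (p L.++ p′) ≡ lin w p + lin w p′
  lin-++ w []            p′ = sym (+-identityˡ _)
  lin-++ w ((a , e) ∷ p) p′ = trans (cong (a * w e +_) (lin-++ w p p′)) (sym (+-assoc _ _ _))

  negate : ∀ {N} → Pol N → Pol N
  negate = L.map (λ t → (- proj₁ t , proj₂ t))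

  lin-negate : ∀ {N} w (p : Pol N) → lin w (negate p) ≡ - lin w p
  lin-negate w []            = sym -0#≡0#
  lin-negate w ((a , e) ∷ p) = trans (cong₂ _+_ (-*-comm a (w e)) (lin-negate w p)) (-‿+-comm _ _)

  coeff-++ : ∀ {N} (p p′ : Pol N) e → coeff (p L.++ p′) e ≡ coeff p e + coeff p′ e
  coeff-++ []             p′ e = sym (+-identityˡ _)
  coeff-++ ((a , e′) ∷ p) p′ e with e′ ≟ₘ e
  ... | yes _ = trans (cong (a +_) (coeff-++ p p′ e)) (sym (+-assoc _ _ _))
  ... | no _  = coeff-++ p p′ e

  coeff-negate : ∀ {N} (p : Pol N) e → coeff (negate p) e ≡ - coeff p e
  coeff-negate []             e = sym -0#≡0#
  coeff-negate ((a , e′) ∷ p) e with e′ ≟ₘ e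
  ... | yes _ = trans (cong (- a +_) (coeff-negate p e)) (-‿+-comm _ _)
  ... | no _  = coeff-negate p e

  _⊖_ : ∀ {N} → Pol N → Pol N → Pol N
  p ⊖ p′ = p L.++ negate p′

  coeff-⊖ : ∀ {N} (p p′ : Pol N) e → coeff (p ⊖ p′) e ≡ coeff p e - coeff p′ e
  coeff-⊖ p p′ e = trans (coeff-++ p (negate p′) e) (cong (coeff p e +_) (coeff-negate p′ e))

  lin-⊖ : ∀ {N} w (p p′ : Pol N) → lin w (p ⊖ p′) ≡ lin w p - lin w p′
  lin-⊖ w p p′ = trans (lin-++ w p (negate p′)) (cong (lin w p +_) (lin-negate w p′))

  eval-⊖ : ∀ {N} (p p′ : Pol N) x → eval (p ⊖ p′) x ≡ eval p x - eval p′ x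
  eval-⊖ p p′ x = begin
    eval (p ⊖ p′) x                  ≡⟨ eval≡lin (p ⊖ p′) x ⟩
    lin _ (p ⊖ p′)                   ≡⟨ lin-⊖ _ p p′ ⟩
    lin _ p - lin _ p′               ≡⟨ sym (cong₂ _-_ (eval≡lin p x) (eval≡lin p′ x)) ⟩
    eval p x - eval p′ x             ∎

  eval-++ : ∀ {N} (p p′ : Pol N) x → eval (p L.++ p′) x ≡ eval p x + eval p′ x
  eval-++ p p′ x = trans (eval≡lin (p L.++ p′) x)
    (trans (lin-++ _ p p′) (sym (cong₂ _+_ (eval≡lin p x) (eval≡lin p′ x))))

  lin-cong-coeff : ∀ {N} w (p p′ : Pol N) → (∀ e → coeff p e ≡ coeff p′ e) → lin w p ≡ lin w p′
  lin-cong-coeff w p p′ same = x-y≡0⇒x≡y _ _ (begin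
      lin w p - lin w p′         ≡⟨ sym (lin-⊖ w p p′) ⟩
      lin w (p ⊖ p′)             ≡⟨ lin-cong-support w (λ _ → 0#) (p ⊖ p′) (λ e → inj₁ (coeff-diff≡0 e)) ⟩
      lin (λ _ → 0#) (p ⊖ p′)    ≡⟨ lin-zero (p ⊖ p′) ⟩
      0#                         ∎)
    where
    coeff-diff≡0 : ∀ e → coeff (p ⊖ p′) e ≡ 0#
    coeff-diff≡0 e = trans (coeff-⊖ p p′ e) (trans (cong (_- coeff p′ e) (same e)) (x-x≡0 _))

  mapMon : ∀ {N N′} → (Mon N → Mon N′) → Pol N → Pol N′
  mapMon h = L.map (λ term → (proj₁ term , h (proj₂ term)))

  coeff-mapMon : ∀ {N N′} (h : Mon N → Mon N′) p e → coeff (mapMon h p) e ≡ lin (λ e′ → δₘ (h e′) e) p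
  coeff-mapMon h []             e = refl
  coeff-mapMon h ((a , e₀) ∷ p) e = step (h e₀ ≟ₘ e)
    where
    rest = lin (λ e′ → δₘ (h e′) e) p
    step : Dec (h e₀ ≡ e) → coeff ((a , h e₀) ∷ mapMon h p) e ≡ a * δₘ (h e₀) e + rest
    step (yes refl) = trans (coeff-head a (h e₀) _)
      (cong₂ _+_ (sym (trans (cong (a *_) (δₘ-≡ (h e₀))) (*-identityʳ a))) (coeff-mapMon h p (h e₀)))
    step (no he₀≢e) = trans (coeff-skip a (h e₀) e _ he₀≢e)
      (trans (coeff-mapMon h p e) (sym (trans (cong (_+ rest) (trans (cong (a *_) (δₘ-≢ he₀≢e)) (zeroʳ a))) (+-identityˡ rest))))

  restrict : ∀ {N} {ℓ} {Q : Mon N → Set ℓ} → (∀ e → Dec (Q e)) → Pol N → Pol N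
  restrict Q? [] = []
  restrict Q? ((a , e) ∷ p) with Q? e
  ... | yes _ = (a , e) ∷ restrict Q? p
  ... | no _  = restrict Q? p

  restrict-satisfies : ∀ {N} {ℓ} {Q : Mon N → Set ℓ} (Q? : ∀ e → Dec (Q e)) p →
                       LA.All (λ term → Q (proj₂ term)) (restrict Q? p)
  restrict-satisfies Q? [] = []ᴸ
  restrict-satisfies Q? ((a , e) ∷ p) with Q? e
  ... | yes Qe = Qe ∷ᴸ restrict-satisfies Q? p
  ... | no _   = restrict-satisfies Q? p

  coeff-restrict-in : ∀ {N} {ℓ} {Q : Mon N → Set ℓ} (Q? : ∀ e → Dec (Q e)) p e →
                      Q e → coeff (restrict Q? p) e ≡ coeff p e
  coeff-restrict-in Q? [] e _ = refl
  coeff-restrict-in Q? ((a , e′) ∷ p) e Qe with Q? e′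
  ... | yes _   = cases (e′ ≟ₘ e)
    where
    IH = coeff-restrict-in Q? p e Qe
    cases : Dec (e′ ≡ e) → coeff ((a , e′) ∷ restrict Q? p) e ≡ coeff ((a , e′) ∷ p) e
    cases (yes refl) = trans (coeff-head a e′ _) (trans (cong (a +_) IH) (sym (coeff-head a e′ p)))
    cases (no e′≢e)  = trans (coeff-skip a e′ e _ e′≢e) (trans IH (sym (coeff-skip a e′ e p e′≢e)))
  ... | no ¬Qe′ = trans (coeff-restrict-in Q? p e Qe) (sym (coeff-skip a e′ e p (λ { refl → ¬Qe′ Qe })))

  coeff-restrict-out : ∀ {N} {ℓ} {Q : Mon N → Set ℓ} (Q? : ∀ e → Dec (Q e)) p e →
                       ¬ Q e → coeff (restrict Q? p) e ≡ 0#
  coeff-restrict-out Q? [] e _ = refl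
  coeff-restrict-out Q? ((a , e′) ∷ p) e ¬Qe with Q? e′
  ... | yes Qe′ = trans (coeff-skip a e′ e _ (λ { refl → ¬Qe Qe′ })) (coeff-restrict-out Q? p e ¬Qe)
  ... | no _    = coeff-restrict-out Q? p e ¬Qe

  coeff≡lin : ∀ {N} (p : Pol N) e → coeff p e ≡ lin (λ e′ → δₘ e′ e) p
  coeff≡lin p e = trans (cong (λ p → coeff p e) (sym (LP.map-id p))) (coeff-mapMon (λ e′ → e′) p e)

  eval-cong-coeff : ∀ {N} (p p′ : Pol N) → (∀ e → coeff p e ≡ coeff p′ e) → ∀ x → eval p x ≡ eval p′ x
  eval-cong-coeff p p′ same x =
    trans (eval≡lin p x) (trans (lin-cong-coeff _ p p′ same) (sym (eval≡lin p′ x)))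


module FiniteField {c} (K : Field c) (r : ℕ) (E : Fin (suc (suc r)) ↔ Field.Carrier K) where
  open Field K
  open Poly K
  open FieldArithmetic K
  open ≡-Reasoning

  q : ℕ
  q = suc (suc r)

  element : Fin q → Carrier
  element = Inverse.to E

  index : Carrier → Fin q
  index = Inverse.from E

  element-index : ∀ x → element (index x) ≡ x
  element-index = Inverse.strictlyInverseˡ E

  index-element : ∀ i → index (element i) ≡ i
  index-element = Inverse.strictlyInverseʳ E

  element-injective : ∀ i j → element i ≡ element j → i ≡ j
  element-injective i j eq = trans (sym (index-element i)) (trans (cong index eq) (index-element j))

  _≟_ : DecidableEquality Carrier
  x ≟ y with index x FP.≟ index y
  ... | yes eq = yes (trans (sym (element-index x)) (trans (cong element eq) (element-index y)))
  ... | no ne  = no (λ eq → ne (cong index eq))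

  ≡-stable : ∀ {x y : Carrier} → ¬ (x ≢ y) → x ≡ y
  ≡-stable {x} {y} ¬x≢y with x ≟ y
  ... | yes x≡y = x≡y
  ... | no x≢y  = ⊥-elim (¬x≢y x≢y)

  module ∏ = CommutativeMonoidSum (CommutativeRing.*-commutativeMonoid ring)

  ∏ : ∀ {n} → (Fin n → Carrier) → Carrier
  ∏ = ∏.sum

  ∏-≢0 : ∀ n (u : Fin n → Carrier) → (∀ i → u i ≢ 0#) → ∏ u ≢ 0#
  ∏-≢0 zero    u u≢0 = 1#≢0#
  ∏-≢0 (suc n) u u≢0 = *-≢0 (u≢0 F.zero) (∏-≢0 n (λ i → u (F.suc i)) (λ i → u≢0 (F.suc i)))

  ∏-const : ∀ n a → ∏ {n} (λ _ → a) ≡ a ^ n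
  ∏-const zero    a = refl
  ∏-const (suc n) a = cong (a *_) (∏-const n a)

  ∏-oneHole : ∀ n (u : Fin (suc n) → Carrier) a i₀ →
              u i₀ ≡ 1# → (∀ i → i ≢ i₀ → u i ≡ a) → ∏ u ≡ a ^ n
  ∏-oneHole n u a i₀ u₀≡1 u≡a = begin
    ∏ u                         ≡⟨ ∏.sum-remove {i = i₀} u ⟩
    u i₀ * ∏ (removeAt u i₀)    ≡⟨ cong₂ _*_ u₀≡1 (∏.sum-cong-≗ (λ j → u≡a _ (FP.punchInᵢ≢i i₀ j))) ⟩
    1# * ∏ {n} (λ _ → a)        ≡⟨ *-identityˡ _ ⟩
    ∏ {n} (λ _ → a)             ≡⟨ ∏-const n a ⟩
    a ^ n                       ∎

  nonzeroPart : Carrier → Carrier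
  nonzeroPart x with x ≟ 0#
  ... | yes _ = 1#
  ... | no _  = x

  nonzeroPart-≢0 : ∀ x → nonzeroPart x ≢ 0#
  nonzeroPart-≢0 x with x ≟ 0#
  ... | yes _   = 1#≢0#
  ... | no x≢0  = x≢0

  -- the factor by which multiplying x by a changes its nonzero part
  factor : Carrier → Carrier → Carrier
  factor a x with x ≟ 0#
  ... | yes _ = 1#
  ... | no _  = a

  nonzeroPart-* : ∀ a x → a ≢ 0# → nonzeroPart (a * x) ≡ factor a x * nonzeroPart x
  nonzeroPart-* a x a≢0 with x ≟ 0# | (a * x) ≟ 0#
  ... | yes _   | yes _     = sym (*-identityˡ 1#)
  ... | yes x≡0 | no ax≢0   = ⊥-elim (ax≢0 (trans (cong (a *_) x≡0) (zeroʳ a)))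
  ... | no x≢0  | yes ax≡0  = ⊥-elim (*-≢0 a≢0 x≢0 ax≡0)
  ... | no _    | no _      = refl

  scaling : ∀ a → a ≢ 0# → Permutation q q
  scaling a a≢0 = mk↔ₛ′ (scale a) (scale a⁻¹) (cancel a a⁻¹ aa⁻¹≡1) (cancel a⁻¹ a a⁻¹a≡1)
    where
    a⁻¹ = proj₁ (inverse a a≢0)
    aa⁻¹≡1 : a * a⁻¹ ≡ 1#
    aa⁻¹≡1 = proj₂ (inverse a a≢0)
    a⁻¹a≡1 : a⁻¹ * a ≡ 1#
    a⁻¹a≡1 = trans (*-comm a⁻¹ a) aa⁻¹≡1
    scale : Carrier → Fin q → Fin q
    scale b i = index (b * element i)
    cancel : ∀ b b′ → b * b′ ≡ 1# → ∀ i → scale b (scale b′ i) ≡ i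
    cancel b b′ bb′≡1 i = begin
      index (b * element (index (b′ * element i)))  ≡⟨ cong (λ x → index (b * x)) (element-index _) ⟩
      index (b * (b′ * element i))                  ≡⟨ cong index (sym (*-assoc b b′ _)) ⟩
      index (b * b′ * element i)                    ≡⟨ cong (λ x → index (x * element i)) bb′≡1 ⟩
      index (1# * element i)                        ≡⟨ cong index (*-identityˡ _) ⟩
      index (element i)                             ≡⟨ index-element i ⟩
      i                                             ∎

  -- a^(q-1) ≡ 1 for a ≢ 0: scaling by a permutes K, so it leaves the product
  -- of all nonzero parts invariant, while multiplying it by a once for each of
  -- the q - 1 nonzero elements
  unit-power : ∀ a → a ≢ 0# → a ^ suc r ≡ 1#
  unit-power a a≢0 = fixes⇒≡1 (a ^ suc r) (∏ g) invariant (∏-≢0 q g (λ i → nonzeroPart-≢0 (element i)))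
    where
    g f : Fin q → Carrier
    g i = nonzeroPart (element i)
    f i = factor a (element i)
    σ = scaling a a≢0
    ∏f≡a^[q-1] : ∏ f ≡ a ^ suc r
    ∏f≡a^[q-1] = ∏-oneHole (suc r) f a (index 0#) f₀≡1 f≡a
      where
      f₀≡1 : f (index 0#) ≡ 1#
      f₀≡1 with element (index 0#) ≟ 0#
      ... | yes _   = refl
      ... | no x≢0  = ⊥-elim (x≢0 (element-index 0#))
      f≡a : ∀ i → i ≢ index 0# → f i ≡ a
      f≡a i i≢i₀ with element i ≟ 0#
      ... | yes x≡0 = ⊥-elim (i≢i₀ (trans (sym (index-element i)) (cong index x≡0)))
      ... | no _    = refl
    invariant : a ^ suc r * ∏ g ≡ ∏ g
    invariant = begin
      a ^ suc r * ∏ g           ≡⟨ cong (_* ∏ g) (sym ∏f≡a^[q-1]) ⟩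
      ∏ f * ∏ g                 ≡⟨ sym (∏.∑-distrib-+ f g) ⟩
      ∏ (λ i → f i * g i)       ≡⟨ ∏.sum-cong-≗ (λ i → sym (nonzeroPart-* a (element i) a≢0)) ⟩
      ∏ {q} (λ i → nonzeroPart (a * element i))
        ≡⟨ ∏.sum-cong-≗ (λ i → cong nonzeroPart (sym (element-index (a * element i)))) ⟩
      ∏ {q} (λ i → g (σ ⟨$⟩ʳ i))    ≡⟨ sym (∏.sum-permute g σ) ⟩
      ∏ g                       ∎

  fermat : ∀ a → a ^ q ≡ a
  fermat a with a ≟ 0#
  ... | yes refl = zeroˡ _
  ... | no a≢0   = trans (cong (a *_) (unit-power a a≢0)) (*-identityʳ a)

-- Univariate polynomials in dense form c₀ + c₁ t + c₂ t² + …  A polynomial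
-- with at most n coefficients vanishing at n distinct points is zero: divide
-- by t - ρ for one root ρ and recurse on the quotient.
module UnivariateRoots {c} (K : Field c) where
  open Field K
  open FieldArithmetic K
  open ≡-Reasoning

  evalDense : List Carrier → Carrier → Carrier
  evalDense []       t = 0#
  evalDense (a ∷ cs) t = a + t * evalDense cs t

  divide : Carrier → List Carrier → List Carrier
  divide ρ []             = []
  divide ρ (c₀ ∷ [])      = []
  divide ρ (c₀ ∷ c₁ ∷ cs) = evalDense (c₁ ∷ cs) ρ ∷ divide ρ (c₁ ∷ cs)

  length-divide : ∀ ρ c₀ cs → L.length (divide ρ (c₀ ∷ cs)) ≡ L.length cs
  length-divide ρ c₀ []        = refl
  length-divide ρ c₀ (c₁ ∷ cs) = cong suc (length-divide ρ c₁ cs)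

  division : ∀ ρ cs t → evalDense cs t ≡ evalDense cs ρ + (t - ρ) * evalDense (divide ρ cs) t
  division ρ [] t = sym (trans (+-identityˡ _) (zeroʳ _))
  division ρ (c₀ ∷ []) t = begin
    c₀ + t * 0#                   ≡⟨ cong (c₀ +_) (trans (zeroʳ t) (sym (zeroʳ ρ))) ⟩
    c₀ + ρ * 0#                   ≡⟨ sym (+-identityʳ _) ⟩
    c₀ + ρ * 0# + 0#              ≡⟨ cong (c₀ + ρ * 0# +_) (sym (zeroʳ (t - ρ))) ⟩
    c₀ + ρ * 0# + (t - ρ) * 0#    ∎
  division ρ (c₀ ∷ c₁ ∷ cs) t = begin
    c₀ + t * evalDense cs′ t              ≡⟨ cong (λ z → c₀ + t * z) (division ρ (c₁ ∷ cs) t) ⟩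
    c₀ + t * (v + d * S)                  ≡⟨ cong (c₀ +_) (distribˡ t v (d * S)) ⟩
    c₀ + (t * v + t * (d * S))            ≡⟨ cong (λ z → c₀ + (z * v + t * (d * S))) t≡ρ+d ⟩
    c₀ + ((ρ + d) * v + t * (d * S))      ≡⟨ cong₂ (λ y z → c₀ + (y + z)) (distribʳ v ρ d) (*-Rearrange.x∙yz≈y∙xz t d S) ⟩
    c₀ + ((ρ * v + d * v) + d * (t * S))  ≡⟨ cong (c₀ +_) (+-assoc _ _ _) ⟩
    c₀ + (ρ * v + (d * v + d * (t * S)))  ≡⟨ sym (+-assoc _ _ _) ⟩
    c₀ + ρ * v + (d * v + d * (t * S))    ≡⟨ cong (c₀ + ρ * v +_) (sym (distribˡ d v (t * S))) ⟩
    c₀ + ρ * v + d * (v + t * S)          ∎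
    where
    cs′ = c₁ ∷ cs
    v = evalDense cs′ ρ
    d = t - ρ
    S = evalDense (divide ρ cs′) t
    t≡ρ+d : t ≡ ρ + d
    t≡ρ+d = sym (begin
      ρ + (t - ρ)     ≡⟨ +-Rearrange.x∙yz≈y∙zx ρ t (- ρ) ⟩
      t + (- ρ + ρ)   ≡⟨ cong (t +_) (-‿inverseˡ ρ) ⟩
      t + 0#          ≡⟨ +-identityʳ t ⟩
      t               ∎)

  zero-quotient : ∀ ρ cs → LA.All (_≡ 0#) (divide ρ cs) → evalDense cs ρ ≡ 0# → LA.All (_≡ 0#) cs
  zero-quotient ρ []             _ _ = []ᴸ
  zero-quotient ρ (c₀ ∷ [])      _ c₀+ρ0≡0 = trans (sym (trans (cong (c₀ +_) (zeroʳ ρ)) (+-identityʳ c₀))) c₀+ρ0≡0 ∷ᴸ []ᴸ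
  zero-quotient ρ (c₀ ∷ c₁ ∷ cs) (v≡0 ∷ᴸ rest) root = c₀≡0 ∷ᴸ zero-quotient ρ (c₁ ∷ cs) rest v≡0
    where
    c₀≡0 : c₀ ≡ 0#
    c₀≡0 = trans (sym (trans (cong (λ z → c₀ + ρ * z) v≡0) (trans (cong (c₀ +_) (zeroʳ ρ)) (+-identityʳ c₀)))) root

  root-bound : ∀ n (ρ : Fin n → Carrier) → (∀ i j → ρ i ≡ ρ j → i ≡ j) →
               ∀ cs → L.length cs ≤ n → (∀ i → evalDense cs (ρ i) ≡ 0#) → LA.All (_≡ 0#) cs
  root-bound n       ρ ρ-inj []        _          _     = []ᴸ
  root-bound (suc n) ρ ρ-inj (c₀ ∷ cs) (ℕ.s≤s len≤n) roots =
    zero-quotient ρ₀ (c₀ ∷ cs) quotient≡0 (roots F.zero)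
    where
    ρ₀ = ρ F.zero
    quotient = divide ρ₀ (c₀ ∷ cs)
    quotient-roots : ∀ i → evalDense quotient (ρ (F.suc i)) ≡ 0#
    quotient-roots i = noZeroDivisors (t - ρ₀) _ product≡0 t-ρ₀≢0
      where
      t = ρ (F.suc i)
      product≡0 : (t - ρ₀) * evalDense quotient t ≡ 0#
      product≡0 = begin
        (t - ρ₀) * evalDense quotient t                          ≡⟨ sym (+-identityˡ _) ⟩
        0# + (t - ρ₀) * evalDense quotient t                     ≡⟨ cong (_+ (t - ρ₀) * evalDense quotient t) (sym (roots F.zero)) ⟩
        evalDense (c₀ ∷ cs) ρ₀ + (t - ρ₀) * evalDense quotient t ≡⟨ sym (division ρ₀ (c₀ ∷ cs) t) ⟩
        evalDense (c₀ ∷ cs) t                                    ≡⟨ roots (F.suc i) ⟩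
        0#                                                       ∎
      t-ρ₀≢0 : t - ρ₀ ≢ 0#
      t-ρ₀≢0 t-ρ₀≡0 with ρ-inj (F.suc i) F.zero (x-y≡0⇒x≡y t ρ₀ t-ρ₀≡0)
      ... | ()
    quotient≡0 : LA.All (_≡ 0#) quotient
    quotient≡0 = root-bound n (λ i → ρ (F.suc i)) (λ i j eq → FP.suc-injective (ρ-inj _ _ eq))
                   quotient (subst (_≤ n) (sym (length-divide ρ₀ c₀ cs)) len≤n) quotient-roots


-- By
-- induction on k: writing D = Σ_d t^d · D_d(x) with D_d the "slice" of D at
-- t-degree d, for fixed x the univariate polynomial Σ_d D_d(x) t^d has fewer
-- than q coefficients and q roots, so every D_d(x) vanishes.
module ReducedUniqueness {c} (K : Field c) (r : ℕ) (E : Fin (suc (suc r)) ↔ Field.Carrier K) where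
  open Field K
  open Poly K
  open FieldArithmetic K
  open LinearFunctionals K
  open FiniteField K r E
  open UnivariateRoots K
  open ≡-Reasoning

  indicator : ℕ → ℕ → Carrier
  indicator zero     zero    = 1#
  indicator zero     (suc _) = 0#
  indicator (suc _)  zero    = 0#
  indicator (suc d′) (suc d) = indicator d′ d

  indicator-≡ : ∀ d → indicator d d ≡ 1#
  indicator-≡ zero    = refl
  indicator-≡ (suc d) = indicator-≡ d

  indicator-≢ : ∀ d′ d → d′ ≢ d → indicator d′ d ≡ 0#
  indicator-≢ zero     zero    d′≢d = ⊥-elim (d′≢d refl)
  indicator-≢ zero     (suc d) _    = refl
  indicator-≢ (suc d′) zero    _    = refl
  indicator-≢ (suc d′) (suc d) d′≢d = indicator-≢ d′ d (λ eq → d′≢d (cong suc eq))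

  evalDense-zeros : ∀ (f : ℕ → Carrier) n t → (∀ d → f d ≡ 0#) → evalDense (L.applyUpTo f n) t ≡ 0#
  evalDense-zeros f zero    t f≡0 = refl
  evalDense-zeros f (suc n) t f≡0 = begin
    f 0 + t * evalDense (L.applyUpTo (λ d → f (suc d)) n) t
      ≡⟨ cong₂ (λ a b → a + t * b) (f≡0 0) (evalDense-zeros (λ d → f (suc d)) n t (λ d → f≡0 (suc d))) ⟩
    0# + t * 0#   ≡⟨ trans (+-identityˡ _) (zeroʳ t) ⟩
    0#            ∎

  evalDense-column : ∀ t M d′ n → d′ ℕ.< n → evalDense (L.applyUpTo (λ d → indicator d′ d * M) n) t ≡ t ^ d′ * M
  evalDense-column t M zero (suc n) _ = begin
    1# * M + t * evalDense (L.applyUpTo (λ d → 0# * M) n) t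
      ≡⟨ cong₂ (λ a b → a + t * b) (*-identityˡ M) (evalDense-zeros _ n t (λ _ → zeroˡ M)) ⟩
    M + t * 0#    ≡⟨ trans (cong (M +_) (zeroʳ t)) (+-identityʳ M) ⟩
    M             ≡⟨ sym (*-identityˡ M) ⟩
    1# * M        ∎
  evalDense-column t M (suc d′) (suc n) (ℕ.s≤s d′<n) = begin
    0# * M + t * evalDense (L.applyUpTo (λ d → indicator d′ d * M) n) t
      ≡⟨ cong₂ (λ a b → a + t * b) (zeroˡ M) (evalDense-column t M d′ n d′<n) ⟩
    0# + t * (t ^ d′ * M)   ≡⟨ +-identityˡ _ ⟩
    t * (t ^ d′ * M)        ≡⟨ sym (*-assoc t _ M) ⟩
    t * t ^ d′ * M          ∎

  lin-evalDense : ∀ {N} (u : ℕ → Mon N → Carrier) p t n →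
    evalDense (L.applyUpTo (λ d → lin (u d) p) n) t ≡ lin (λ e → evalDense (L.applyUpTo (λ d → u d e) n) t) p
  lin-evalDense u p t zero    = sym (lin-zero p)
  lin-evalDense u p t (suc n) = begin
    lin (u 0) p + t * evalDense (L.applyUpTo (λ d → lin (u (suc d)) p) n) t
      ≡⟨ cong (λ z → lin (u 0) p + t * z) (lin-evalDense (λ d → u (suc d)) p t n) ⟩
    lin (u 0) p + t * lin (λ e → evalDense (L.applyUpTo (λ d → u (suc d) e) n) t) p
      ≡⟨ sym (lin-affine (u 0) _ t p) ⟩
    lin (λ e → u 0 e + t * evalDense (L.applyUpTo (λ d → u (suc d) e) n) t) p ∎

  slice : ∀ {k} → ℕ → Pol (suc k) → Pol k
  slice d = L.map (λ { (a , d′ ∷ e) → (indicator d′ d * a , e) })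

  coeff-slice : ∀ {k} d (D : Pol (suc k)) e → coeff (slice d D) e ≡ coeff D (d ∷ e)
  coeff-slice d [] e = refl
  coeff-slice d ((a , d′ ∷ e′) ∷ D) e = cases (e′ ≟ₘ e) (d′ ℕ.≟ d)
    where
    IH = coeff-slice d D
    cases : Dec (e′ ≡ e) → Dec (d′ ≡ d) → coeff ((indicator d′ d * a , e′) ∷ slice d D) e ≡ coeff ((a , d′ ∷ e′) ∷ D) (d ∷ e)
    cases (yes refl) (yes refl) = begin
      coeff ((indicator d d * a , e′) ∷ slice d D) e′   ≡⟨ coeff-head _ e′ (slice d D) ⟩
      indicator d d * a + coeff (slice d D) e′          ≡⟨ cong₂ _+_ (trans (cong (_* a) (indicator-≡ d)) (*-identityˡ a)) (IH e′) ⟩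
      a + coeff D (d ∷ e′)                              ≡⟨ sym (coeff-head a (d ∷ e′) D) ⟩
      coeff ((a , d ∷ e′) ∷ D) (d ∷ e′)                 ∎
    cases (yes refl) (no d′≢d) = begin
      coeff ((indicator d′ d * a , e′) ∷ slice d D) e′  ≡⟨ coeff-head _ e′ (slice d D) ⟩
      indicator d′ d * a + coeff (slice d D) e′         ≡⟨ cong₂ _+_ (trans (cong (_* a) (indicator-≢ d′ d d′≢d)) (zeroˡ a)) (IH e′) ⟩
      0# + coeff D (d ∷ e′)                             ≡⟨ +-identityˡ _ ⟩
      coeff D (d ∷ e′)                                  ≡⟨ sym (coeff-skip a (d′ ∷ e′) (d ∷ e′) D (λ eq → d′≢d (VP.∷-injectiveˡ eq))) ⟩
      coeff ((a , d′ ∷ e′) ∷ D) (d ∷ e′)                ∎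
    cases (no e′≢e) _ = begin
      coeff ((indicator d′ d * a , e′) ∷ slice d D) e   ≡⟨ coeff-skip _ e′ e (slice d D) e′≢e ⟩
      coeff (slice d D) e                               ≡⟨ IH e ⟩
      coeff D (d ∷ e)                                   ≡⟨ sym (coeff-skip a (d′ ∷ e′) (d ∷ e) D (λ eq → e′≢e (VP.∷-injectiveʳ eq))) ⟩
      coeff ((a , d′ ∷ e′) ∷ D) (d ∷ e)                 ∎

  sliceWeight : ∀ {k} → Vec Carrier k → ℕ → Mon (suc k) → Carrier
  sliceWeight xs d (d′ ∷ e) = indicator d′ d * evalMon e xs

  eval-slice : ∀ {k} d (D : Pol (suc k)) xs → eval (slice d D) xs ≡ lin (sliceWeight xs d) D
  eval-slice d [] xs = refl
  eval-slice d ((a , d′ ∷ e) ∷ D) xs =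
    cong₂ _+_ (*-Rearrange.xy∙z≈y∙xz (indicator d′ d) a (evalMon e xs)) (eval-slice d D xs)

  DegLt-slice : ∀ {k} d (D : Pol (suc k)) → DegLt q D → DegLt q (slice d D)
  DegLt-slice d D deg e c≢0 with deg (d ∷ e) (λ c≡0 → c≢0 (trans (coeff-slice d D e) c≡0))
  ... | _ ∷ d<q = d<q

  coeff-outside : ∀ {N} (D : Pol N) → DegLt q D → ∀ e → ¬ All (ℕ._< q) e → coeff D e ≡ 0#
  coeff-outside D deg e out = ≡-stable (λ c≢0 → out (deg e c≢0))

  dense-expansion : ∀ {k} (D : Pol (suc k)) → DegLt q D → ∀ t xs →
    eval D (t ∷ xs) ≡ evalDense (L.applyUpTo (λ d → lin (sliceWeight xs d) D) q) t
  dense-expansion D deg t xs = begin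
    eval D (t ∷ xs)                 ≡⟨ eval≡lin D (t ∷ xs) ⟩
    lin (λ e → evalMon e (t ∷ xs)) D
      ≡⟨ lin-cong-support _ _ D column ⟩
    lin (λ e → evalDense (L.applyUpTo (λ d → sliceWeight xs d e) q) t) D
      ≡⟨ sym (lin-evalDense (sliceWeight xs) D t q) ⟩
    evalDense (L.applyUpTo (λ d → lin (sliceWeight xs d) D) q) t ∎
    where
    column : ∀ e → coeff D e ≡ 0# ⊎ evalMon e (t ∷ xs) ≡ evalDense (L.applyUpTo (λ d → sliceWeight xs d e) q) t
    column (d′ ∷ e) with d′ ℕ.<? q
    ... | yes d′<q = inj₂ (sym (evalDense-column t (evalMon e xs) d′ q d′<q))
    ... | no d′≮q  = inj₁ (coeff-outside D deg (d′ ∷ e) (λ { (d′<q ∷ _) → d′≮q d′<q }))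

  coeff≡eval₀ : ∀ (D : Pol 0) → coeff D [] ≡ eval D []
  coeff≡eval₀ [] = refl
  coeff≡eval₀ ((a , []) ∷ D) = trans (coeff-head a [] D) (cong₂ _+_ (sym (*-identityʳ a)) (coeff≡eval₀ D))

  reduced-zero : ∀ k (D : Pol k) → DegLt q D → (∀ x → eval D x ≡ 0#) → ∀ e → coeff D e ≡ 0#
  reduced-zero zero D deg D≡0 [] = trans (coeff≡eval₀ D) (D≡0 [])
  reduced-zero (suc k) D deg D≡0 (d ∷ e) with d ℕ.<? q
  ... | no d≮q = coeff-outside D deg (d ∷ e) (λ { (d<q ∷ _) → d≮q d<q })
  ... | yes d<q = trans (sym (coeff-slice d D e)) (reduced-zero k (slice d D) (DegLt-slice d D deg) slice≡0 e)
    where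
    slice≡0 : ∀ xs → eval (slice d D) xs ≡ 0#
    slice≡0 xs = trans (eval-slice d D xs) (LAP.applyUpTo⁻ (λ d → lin (sliceWeight xs d) D) q all-zero d<q)
      where
      all-zero : LA.All (_≡ 0#) (L.applyUpTo (λ d → lin (sliceWeight xs d) D) q)
      all-zero = root-bound q element element-injective _
        (ℕP.≤-reflexive (LP.length-applyUpTo (λ d → lin (sliceWeight xs d) D) q))
        (λ i → trans (sym (dense-expansion D deg (element i) xs)) (D≡0 (element i ∷ xs)))

  reduced-unique : ∀ {k} (P P′ : Pol k) (f : Vec Carrier k → Carrier) → DegLt q P → DegLt q P′ →
                   Represents P f → Represents P′ f → ∀ e → coeff P e ≡ coeff P′ e
  reduced-unique {k} P P′ f deg deg′ rep rep′ e =
    x-y≡0⇒x≡y _ _ (trans (sym (coeff-⊖ P P′ e)) (reduced-zero k (P ⊖ P′) deg-⊖ eval≡0 e))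
    where
    deg-⊖ : DegLt q (P ⊖ P′)
    deg-⊖ e c≢0 with coeff P e ≟ 0# | coeff P′ e ≟ 0#
    ... | no cP≢0  | _          = deg e cP≢0
    ... | yes _    | no cP′≢0   = deg′ e cP′≢0
    ... | yes cP≡0 | yes cP′≡0  = ⊥-elim (c≢0 (trans (coeff-⊖ P P′ e) (trans (cong₂ _-_ cP≡0 cP′≡0) (x-x≡0 0#))))
    eval≡0 : ∀ x → eval (P ⊖ P′) x ≡ 0#
    eval≡0 x = trans (eval-⊖ P P′ x) (trans (cong₂ _-_ (rep x) (rep′ x)) (x-x≡0 (f x)))

-- Existence of reduced representatives, by Lagrange interpolation in one
-- variable at a time: with δₐ(t) = 1 - (t - a)^(q-1), which is 1 at a and 0
-- elsewhere (Fermat), f(t, x) = Σ_a δₐ(t) · f(a, x), where f(a, ·) is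
-- interpolated recursively.  Univariate polynomials are handled in sparse form
-- (coefficient, exponent) so that they can be multiplied.
module Interpolation {c} (K : Field c) (r : ℕ) (E : Fin (suc (suc r)) ↔ Field.Carrier K) where
  open Field K
  open Poly K
  open FieldArithmetic K
  open LinearFunctionals K
  open FiniteField K r E
  open ≡-Reasoning

  Sparse : Set c
  Sparse = List (Carrier × ℕ)

  evalSparse : Sparse → Carrier → Carrier
  evalSparse []            t = 0#
  evalSparse ((a , d) ∷ u) t = a * t ^ d + evalSparse u t

  DegAtMost : ℕ → Sparse → Set c
  DegAtMost n u = LA.All (λ term → proj₂ term ≤ n) u

  evalSparse-++ : ∀ u v t → evalSparse (u L.++ v) t ≡ evalSparse u t + evalSparse v t
  evalSparse-++ []            v t = sym (+-identityˡ _)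
  evalSparse-++ ((a , d) ∷ u) v t = trans (cong (a * t ^ d +_) (evalSparse-++ u v t)) (sym (+-assoc _ _ _))

  shift : Carrier → ℕ → Sparse → Sparse
  shift a d = L.map (λ term → (a * proj₁ term , d ℕ.+ proj₂ term))

  evalSparse-shift : ∀ a d v t → evalSparse (shift a d v) t ≡ a * t ^ d * evalSparse v t
  evalSparse-shift a d []            t = sym (zeroʳ _)
  evalSparse-shift a d ((b , e) ∷ v) t = begin
    a * b * t ^ (d ℕ.+ e) + evalSparse (shift a d v) t
      ≡⟨ cong₂ _+_ (cong (a * b *_) (^-+ t d e)) (evalSparse-shift a d v t) ⟩
    a * b * (t ^ d * t ^ e) + a * t ^ d * evalSparse v t
      ≡⟨ cong (_+ a * t ^ d * evalSparse v t) (*-Rearrange.interchange a b (t ^ d) (t ^ e)) ⟩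
    a * t ^ d * (b * t ^ e) + a * t ^ d * evalSparse v t
      ≡⟨ sym (distribˡ _ _ _) ⟩
    a * t ^ d * (b * t ^ e + evalSparse v t) ∎

  mul : Sparse → Sparse → Sparse
  mul []            v = []
  mul ((a , d) ∷ u) v = shift a d v L.++ mul u v

  evalSparse-mul : ∀ u v t → evalSparse (mul u v) t ≡ evalSparse u t * evalSparse v t
  evalSparse-mul []            v t = sym (zeroˡ _)
  evalSparse-mul ((a , d) ∷ u) v t = begin
    evalSparse (shift a d v L.++ mul u v) t               ≡⟨ evalSparse-++ (shift a d v) (mul u v) t ⟩
    evalSparse (shift a d v) t + evalSparse (mul u v) t   ≡⟨ cong₂ _+_ (evalSparse-shift a d v t) (evalSparse-mul u v t) ⟩
    a * t ^ d * evalSparse v t + evalSparse u t * evalSparse v t ≡⟨ sym (distribʳ _ _ _) ⟩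
    (a * t ^ d + evalSparse u t) * evalSparse v t         ∎

  DegAtMost-mul : ∀ m n u v → DegAtMost m u → DegAtMost n v → DegAtMost (m ℕ.+ n) (mul u v)
  DegAtMost-mul m n []            v []ᴸ           _  = []ᴸ
  DegAtMost-mul m n ((a , d) ∷ u) v (d≤m ∷ᴸ u≤m) v≤n =
    LAP.++⁺ (LAP.map⁺ (LA.map (ℕP.+-mono-≤ d≤m) v≤n)) (DegAtMost-mul m n u v u≤m v≤n)

  linear : Carrier → Sparse
  linear a = (1# , 1) ∷ (- a , 0) ∷ []

  linearPower : Carrier → ℕ → Sparse
  linearPower a zero    = (1# , 0) ∷ []
  linearPower a (suc n) = mul (linear a) (linearPower a n)

  evalSparse-linearPower : ∀ a n t → evalSparse (linearPower a n) t ≡ (t - a) ^ n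
  evalSparse-linearPower a zero    t = trans (cong (_+ 0#) (*-identityʳ 1#)) (+-identityʳ 1#)
  evalSparse-linearPower a (suc n) t = trans (evalSparse-mul (linear a) (linearPower a n) t)
    (cong₂ _*_ evalSparse-linear (evalSparse-linearPower a n t))
    where
    evalSparse-linear : 1# * (t * 1#) + (- a * 1# + 0#) ≡ t - a
    evalSparse-linear = cong₂ _+_ (trans (*-identityˡ _) (*-identityʳ t)) (trans (+-identityʳ _) (*-identityʳ _))

  DegAtMost-linearPower : ∀ a n → DegAtMost n (linearPower a n)
  DegAtMost-linearPower a zero    = ℕ.z≤n ∷ᴸ []ᴸ
  DegAtMost-linearPower a (suc n) =
    DegAtMost-mul 1 n (linear a) _ (ℕP.≤-refl ∷ᴸ ℕ.z≤n ∷ᴸ []ᴸ) (DegAtMost-linearPower a n)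

  δ : Carrier → Sparse
  δ a = (1# , 0) ∷ L.map (λ term → (- proj₁ term , proj₂ term)) (linearPower a (suc r))

  evalSparse-δ : ∀ a t → evalSparse (δ a) t ≡ 1# - (t - a) ^ suc r
  evalSparse-δ a t = cong₂ _+_ (*-identityʳ 1#)
    (trans (evalSparse-negate (linearPower a (suc r))) (cong -_ (evalSparse-linearPower a (suc r) t)))
    where
    evalSparse-negate : ∀ u → evalSparse (L.map (λ term → (- proj₁ term , proj₂ term)) u) t ≡ - evalSparse u t
    evalSparse-negate []            = sym -0#≡0#
    evalSparse-negate ((b , d) ∷ u) = trans (cong₂ _+_ (-*-comm b (t ^ d)) (evalSparse-negate u)) (-‿+-comm _ _)

  δ-at : ∀ a → evalSparse (δ a) a ≡ 1#
  δ-at a = begin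
    evalSparse (δ a) a          ≡⟨ evalSparse-δ a a ⟩
    1# - (a - a) ^ suc r        ≡⟨ cong (λ z → 1# - z ^ suc r) (x-x≡0 a) ⟩
    1# - 0# * 0# ^ r            ≡⟨ cong (λ z → 1# - z) (zeroˡ _) ⟩
    1# - 0#                     ≡⟨ trans (cong (1# +_) -0#≡0#) (+-identityʳ 1#) ⟩
    1#                          ∎

  δ-away : ∀ a t → t ≢ a → evalSparse (δ a) t ≡ 0#
  δ-away a t t≢a = begin
    evalSparse (δ a) t          ≡⟨ evalSparse-δ a t ⟩
    1# - (t - a) ^ suc r        ≡⟨ cong (λ z → 1# - z) (unit-power (t - a) (λ eq → t≢a (x-y≡0⇒x≡y t a eq))) ⟩
    1# - 1#                     ≡⟨ x-x≡0 1# ⟩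
    0#                          ∎

  DegAtMost-δ : ∀ a → DegAtMost (suc r) (δ a)
  DegAtMost-δ a = ℕ.z≤n ∷ᴸ LAP.map⁺ (DegAtMost-linearPower a (suc r))

  TermsBelow : ∀ {k} → Pol k → Set c
  TermsBelow P = LA.All (λ term → All (ℕ._< q) (proj₂ term)) P

  TermsBelow⇒DegLt : ∀ {k} (P : Pol k) → TermsBelow P → DegLt q P
  TermsBelow⇒DegLt []             []ᴸ            e c≢0 = ⊥-elim (c≢0 refl)
  TermsBelow⇒DegLt ((a , e′) ∷ P) (e′<q ∷ᴸ P<q) e c≢0 with e′ ≟ₘ e
  ... | yes refl = e′<q
  ... | no _     = TermsBelow⇒DegLt P P<q e c≢0

  tensor : ∀ {k} → Sparse → Pol k → Pol (suc k)
  tensor []            P = []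
  tensor ((a , d) ∷ u) P = L.map (λ term → (a * proj₁ term , d ∷ proj₂ term)) P L.++ tensor u P

  eval-tensor : ∀ {k} u (P : Pol k) t xs → eval (tensor u P) (t ∷ xs) ≡ evalSparse u t * eval P xs
  eval-tensor []            P t xs = sym (zeroˡ _)
  eval-tensor ((a , d) ∷ u) P t xs = begin
    eval (term-times P L.++ tensor u P) (t ∷ xs)
      ≡⟨ eval-++ (term-times P) (tensor u P) (t ∷ xs) ⟩
    eval (term-times P) (t ∷ xs) + eval (tensor u P) (t ∷ xs)
      ≡⟨ cong₂ _+_ (eval-term-times P) (eval-tensor u P t xs) ⟩
    a * t ^ d * eval P xs + evalSparse u t * eval P xs
      ≡⟨ sym (distribʳ _ _ _) ⟩
    (a * t ^ d + evalSparse u t) * eval P xs ∎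
    where
    term-times : ∀ {k} → Pol k → Pol (suc k)
    term-times = L.map (λ term → (a * proj₁ term , d ∷ proj₂ term))
    eval-term-times : ∀ {k} (P : Pol k) {xs} → eval (term-times P) (t ∷ xs) ≡ a * t ^ d * eval P xs
    eval-term-times []            = sym (zeroʳ _)
    eval-term-times ((b , e) ∷ P) {xs} = trans
      (cong₂ _+_ (*-Rearrange.interchange a b (t ^ d) (evalMon e xs)) (eval-term-times P))
      (sym (distribˡ _ _ _))

  TermsBelow-tensor : ∀ {k} u (P : Pol k) → DegAtMost (suc r) u → TermsBelow P → TermsBelow (tensor u P)
  TermsBelow-tensor []            P []ᴸ          _   = []ᴸ
  TermsBelow-tensor ((a , d) ∷ u) P (d≤ ∷ᴸ u≤) P<q =
    LAP.++⁺ (LAP.map⁺ (LA.map (ℕ.s≤s d≤ ∷_) P<q)) (TermsBelow-tensor u P u≤ P<q)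

  module Σ = CommutativeMonoidSum (CommutativeRing.+-commutativeMonoid ring)

  ⨁ : ∀ {N} n → (Fin n → Pol N) → Pol N
  ⨁ zero    g = []
  ⨁ (suc n) g = g F.zero L.++ ⨁ n (λ i → g (F.suc i))

  eval-⨁ : ∀ {N} n (g : Fin n → Pol N) x → eval (⨁ n g) x ≡ Σ.sum (λ i → eval (g i) x)
  eval-⨁ zero    g x = refl
  eval-⨁ (suc n) g x = trans (eval-++ (g F.zero) _ x) (cong (eval (g F.zero) x +_) (eval-⨁ n _ x))

  TermsBelow-⨁ : ∀ {N} n (g : Fin n → Pol N) → (∀ i → TermsBelow (g i)) → TermsBelow (⨁ n g)
  TermsBelow-⨁ zero    g _    = []ᴸ
  TermsBelow-⨁ (suc n) g g<q  = LAP.++⁺ (g<q F.zero) (TermsBelow-⨁ n _ (λ i → g<q (F.suc i)))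

  Σ-oneHot : ∀ n (h : Fin (suc n) → Carrier) i₀ → (∀ i → i ≢ i₀ → h i ≡ 0#) → Σ.sum h ≡ h i₀
  Σ-oneHot n h i₀ h≡0 = begin
    Σ.sum h                          ≡⟨ Σ.sum-remove {i = i₀} h ⟩
    h i₀ + Σ.sum (removeAt h i₀)     ≡⟨ cong (h i₀ +_) (Σ.sum-cong-≗ (λ j → h≡0 _ (FP.punchInᵢ≢i i₀ j))) ⟩
    h i₀ + Σ.sum {n} (λ _ → 0#)      ≡⟨ cong (h i₀ +_) (Σ.sum-replicate-zero n) ⟩
    h i₀ + 0#                        ≡⟨ +-identityʳ _ ⟩
    h i₀                             ∎

  interpolate : ∀ k → (Vec Carrier k → Carrier) → Pol k
  interpolate zero    f = (f [] , []) ∷ []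
  interpolate (suc k) f = ⨁ q (λ i → tensor (δ (element i)) (interpolate k (λ xs → f (element i ∷ xs))))

  TermsBelow-interpolate : ∀ k f → TermsBelow (interpolate k f)
  TermsBelow-interpolate zero    f = [] ∷ᴸ []ᴸ
  TermsBelow-interpolate (suc k) f = TermsBelow-⨁ q _ (λ i →
    TermsBelow-tensor _ _ (DegAtMost-δ (element i)) (TermsBelow-interpolate k (λ xs → f (element i ∷ xs))))

  interpolate-represents : ∀ k f → Represents (interpolate k f) f
  interpolate-represents zero    f [] = trans (cong (_+ 0#) (*-identityʳ (f []))) (+-identityʳ _)
  interpolate-represents (suc k) f (t ∷ xs) = begin
    eval (interpolate (suc k) f) (t ∷ xs)
      ≡⟨ eval-⨁ q branch (t ∷ xs) ⟩
    Σ.sum (λ i → eval (branch i) (t ∷ xs))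
      ≡⟨ Σ-oneHot (suc r) (λ i → eval (branch i) (t ∷ xs)) (index t) other-branches ⟩
    eval (branch (index t)) (t ∷ xs)
      ≡⟨ eval-tensor (δ (element (index t))) (interpolate k (λ ys → f (element (index t) ∷ ys))) t xs ⟩
    evalSparse (δ (element (index t))) t * eval (interpolate k (λ ys → f (element (index t) ∷ ys))) xs
      ≡⟨ cong₂ _*_ (trans (cong (λ a → evalSparse (δ a) t) (element-index t)) (δ-at t))
                   (interpolate-represents k _ xs) ⟩
    1# * f (element (index t) ∷ xs)
      ≡⟨ trans (*-identityˡ _) (cong (λ a → f (a ∷ xs)) (element-index t)) ⟩
    f (t ∷ xs) ∎
    where
    branch : Fin q → Pol (suc k)
    branch i = tensor (δ (element i)) (interpolate k (λ ys → f (element i ∷ ys)))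
    other-branches : ∀ i → i ≢ index t → eval (branch i) (t ∷ xs) ≡ 0#
    other-branches i i≢ = begin
      eval (branch i) (t ∷ xs)
        ≡⟨ eval-tensor (δ (element i)) Pᵢ t xs ⟩
      evalSparse (δ (element i)) t * eval Pᵢ xs
        ≡⟨ cong (_* eval Pᵢ xs) (δ-away (element i) t (λ t≡ → i≢ (trans (sym (index-element i)) (cong index (sym t≡))))) ⟩
      0# * eval Pᵢ xs  ≡⟨ zeroˡ _ ⟩
      0#               ∎
      where Pᵢ = interpolate k (λ ys → f (element i ∷ ys))

  reduced-exists : ∀ {k} (f : Vec Carrier k → Carrier) → ∃[ P ] (DegLt q P × Represents P f)
  reduced-exists {k} f = interpolate k f
                       , TermsBelow⇒DegLt _ (TermsBelow-interpolate k f)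
                       , interpolate-represents k f


-- Reducing exponents: on K, t ^ d depends only on d modulo q - 1 (for d ≥ 1),
-- so every exponent can be replaced by one below q.
module ExponentReduction {c} (K : Field c) (r : ℕ) (E : Fin (suc (suc r)) ↔ Field.Carrier K) where
  open Field K
  open Poly K
  open FieldArithmetic K
  open FiniteField K r E
  open ≡-Reasoning

  reduceExp : ℕ → ℕ
  reduceExp zero     = zero
  reduceExp (suc d′) = suc (d′ DM.% suc r)

  reduceExp<q : ∀ d → reduceExp d ℕ.< q
  reduceExp<q zero     = ℕ.s≤s ℕ.z≤n
  reduceExp<q (suc d′) = ℕ.s≤s (DM.m%n<n d′ (suc r))

  reduceExp≤ : ∀ d → reduceExp d ≤ d
  reduceExp≤ zero     = ℕ.z≤n
  reduceExp≤ (suc d′) = ℕ.s≤s (DM.m%n≤m d′ (suc r))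

  reduceExp-small : ∀ d → d ℕ.< q → reduceExp d ≡ d
  reduceExp-small zero     _              = refl
  reduceExp-small (suc d′) (ℕ.s≤s d′<q-1) = cong suc (DM.m<n⇒m%n≡m d′<q-1)

  ^-period : ∀ t a j → t ^ (suc a ℕ.+ j ℕ.* suc r) ≡ t ^ suc a
  ^-period t a zero    = cong (λ d → t ^ suc d) (ℕP.+-identityʳ a)
  ^-period t a (suc j) = begin
    t ^ suc (a ℕ.+ (suc r ℕ.+ j ℕ.* suc r))
      ≡⟨ cong (λ d → t ^ suc d) (CommutativeSemigroupProperties.x∙yz≈y∙xz ℕP.+-commutativeSemigroup a (suc r) (j ℕ.* suc r)) ⟩
    t ^ (q ℕ.+ (a ℕ.+ j ℕ.* suc r))    ≡⟨ ^-+ t q _ ⟩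
    t ^ q * t ^ (a ℕ.+ j ℕ.* suc r)    ≡⟨ cong (_* t ^ (a ℕ.+ j ℕ.* suc r)) (fermat t) ⟩
    t ^ (suc a ℕ.+ j ℕ.* suc r)        ≡⟨ ^-period t a j ⟩
    t ^ suc a                          ∎

  ^-reduceExp : ∀ t d → t ^ reduceExp d ≡ t ^ d
  ^-reduceExp t zero     = refl
  ^-reduceExp t (suc d′) = trans (sym (^-period t (d′ DM.% suc r) (d′ DM./ suc r)))
                                 (cong (λ d → t ^ suc d) (sym (DM.m≡m%n+[m/n]*n d′ (suc r))))

  evalMon-reduceExp : ∀ {n} (e : Mon n) x → evalMon (V.map reduceExp e) x ≡ evalMon e x
  evalMon-reduceExp []      []       = refl
  evalMon-reduceExp (d ∷ e) (x ∷ xs) = cong₂ _*_ (^-reduceExp x d) (evalMon-reduceExp e xs)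

  reduceExp-divides : ∀ {n} (e : Mon n) → V.map reduceExp e ∣ₘ e
  reduceExp-divides []      = VPW.[]
  reduceExp-divides (d ∷ e) = reduceExp≤ d VPW.∷ reduceExp-divides e

  reduceExp-small-mon : ∀ {n} (e : Mon n) → All (ℕ._< q) e → V.map reduceExp e ≡ e
  reduceExp-small-mon []      []          = refl
  reduceExp-small-mon (d ∷ e) (d<q ∷ e<q) = cong₂ _∷_ (reduceExp-small d d<q) (reduceExp-small-mon e e<q)

  reduceExp-all<q : ∀ {n} (e : Mon n) → All (ℕ._< q) (V.map reduceExp e)
  reduceExp-all<q []      = []
  reduceExp-all<q (d ∷ e) = reduceExp<q d ∷ reduceExp-all<q e

module MonomialOrder {c} (K : Field c) where
  open Poly K
  open ≡-Reasoning

  lexKey : ∀ {n} → Mon n → List ℕ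
  lexKey e = V.toList (V.reverse e)

  lexKey-++ : ∀ {a b} (u : Mon a) (w : Mon b) → lexKey (u V.++ w) ≡ lexKey w L.++ lexKey u
  lexKey-++ u w = begin
    lexKey (u V.++ w)                                     ≡⟨ VP.toList-reverse (u V.++ w) ⟩
    L.reverse (V.toList (u V.++ w))                       ≡⟨ cong L.reverse (VP.toList-++ u w) ⟩
    L.reverse (V.toList u L.++ V.toList w)                ≡⟨ LP.reverse-++ (V.toList u) (V.toList w) ⟩
    L.reverse (V.toList w) L.++ L.reverse (V.toList u)    ≡⟨ sym (cong₂ L._++_ (VP.toList-reverse w) (VP.toList-reverse u)) ⟩
    lexKey w L.++ lexKey u                                ∎

  lexKey-injective : ∀ {n} (u v : Mon n) → lexKey u ≡ lexKey v → u ≡ v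
  lexKey-injective u v eq = VP.reverse-injective
    (trans (sym (VP.cast-is-id refl (V.reverse u))) (VP.toList-injective refl (V.reverse u) (V.reverse v) eq))

  length-lexKey : ∀ {n} (u : Mon n) → L.length (lexKey u) ≡ n
  length-lexKey u = VP.length-toList (V.reverse u)

  lexKey-mono : ∀ {n} {u v : Mon n} → u ∣ₘ v → LPW.Pointwise _≤_ (lexKey u) (lexKey v)
  lexKey-mono {u = u} {v} u∣v = subst₂ (LPW.Pointwise _≤_) (sym (VP.toList-reverse u)) (sym (VP.toList-reverse v))
                                  (LPW.reverse⁺ (toList⁺ u∣v))
    where
    toList⁺ : ∀ {n} {u v : Mon n} → u ∣ₘ v → LPW.Pointwise _≤_ (V.toList u) (V.toList v)
    toList⁺ VPW.[]          = LPW.[]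
    toList⁺ (a≤b VPW.∷ u∣v) = a≤b LPW.∷ toList⁺ u∣v

  LexLt-irrefl : ∀ {as} → ¬ LexLt as as
  LexLt-irrefl (here a<a)  = ℕP.<-irrefl refl a<a
  LexLt-irrefl (there lt)  = LexLt-irrefl lt

  ≤⇒¬> : ∀ {as bs} → LPW.Pointwise _≤_ as bs → ¬ LexLt bs as
  ≤⇒¬> (a≤b LPW.∷ _)   (here b<a) = ℕP.<⇒≱ b<a a≤b
  ≤⇒¬> (_   LPW.∷ as≤bs) (there lt) = ≤⇒¬> as≤bs lt

  ≤∧≢⇒< : ∀ {as bs} → LPW.Pointwise _≤_ as bs → as ≢ bs → LexLt as bs
  ≤∧≢⇒< LPW.[] as≢bs = ⊥-elim (as≢bs refl)
  ≤∧≢⇒< {a ∷ as} (a≤b LPW.∷ as≤bs) as≢bs with ℕP.m≤n⇒m<n∨m≡n a≤b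
  ... | inj₁ a<b  = here a<b
  ... | inj₂ refl = there (≤∧≢⇒< as≤bs (λ eq → as≢bs (cong (a ∷_) eq)))

  LexLt-++⁺ : ∀ {zs zs′} xs ys → L.length zs ≡ L.length zs′ → LexLt zs zs′ → LexLt (zs L.++ xs) (zs′ L.++ ys)
  LexLt-++⁺ xs ys len (here z<z′) = here z<z′
  LexLt-++⁺ xs ys len (there lt)  = there (LexLt-++⁺ xs ys (ℕP.suc-injective len) lt)

  LexLt-++⁻ : ∀ zs zs′ {xs ys} → L.length zs ≡ L.length zs′ → LexLt (zs L.++ xs) (zs′ L.++ ys) →
              LexLt zs zs′ ⊎ (zs ≡ zs′ × LexLt xs ys)
  LexLt-++⁻ []       []        len lt         = inj₂ (refl , lt)
  LexLt-++⁻ (z ∷ zs) (z′ ∷ zs′) len (here z<z′) = inj₁ (here z<z′)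
  LexLt-++⁻ (z ∷ zs) (z ∷ zs′) len (there lt) with LexLt-++⁻ zs zs′ (ℕP.suc-injective len) lt
  ... | inj₁ zs<zs′        = inj₁ (there zs<zs′)
  ... | inj₂ (refl , xs<ys) = inj₂ (refl , xs<ys)

  LexLt-asym : ∀ {as bs} → LexLt as bs → ¬ LexLt bs as
  LexLt-asym (here a<b)  (here b<a)  = ℕP.<-asym a<b b<a
  LexLt-asym (here a<a)  (there _)   = ℕP.<-irrefl refl a<a
  LexLt-asym (there _)   (here a<a)  = ℕP.<-irrefl refl a<a
  LexLt-asym (there lt)  (there lt′) = LexLt-asym lt lt′

  IsLM-unique : ∀ {N} {p : Pol N} {e f : Mon N} → IsLM p e → IsLM p f → e ≡ f
  IsLM-unique (ce≢0 , below-e) (cf≢0 , below-f) with below-e _ cf≢0 | below-f _ ce≢0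
  ... | inj₁ f≡e | _        = sym f≡e
  ... | inj₂ _   | inj₁ e≡f = e≡f
  ... | inj₂ f<e | inj₂ e<f = ⊥-elim (LexLt-asym f<e e<f)

  ∣ₘ⇒≯ : ∀ {n} {e f : Mon n} → e ∣ₘ f → ¬ (f <lex e)
  ∣ₘ⇒≯ e∣f = ≤⇒¬> (lexKey-mono e∣f)

  ∣ₘ∧≢⇒< : ∀ {n} {e f : Mon n} → e ∣ₘ f → e ≢ f → e <lex f
  ∣ₘ∧≢⇒< {e = e} {f} e∣f e≢f = ≤∧≢⇒< (lexKey-mono e∣f) (λ eq → e≢f (lexKey-injective e f eq))

  <lex-byHigh : ∀ {a b} (x x′ : Mon a) (z z′ : Mon b) → z ∣ₘ z′ → z ≢ z′ → (x V.++ z) <lex (x′ V.++ z′)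
  <lex-byHigh x x′ z z′ z∣z′ z≢z′ = subst₂ LexLt (sym (lexKey-++ x z)) (sym (lexKey-++ x′ z′))
    (LexLt-++⁺ (lexKey x) (lexKey x′) (trans (length-lexKey z) (sym (length-lexKey z′))) (∣ₘ∧≢⇒< z∣z′ z≢z′))

  <lex-highBlock : ∀ {a b} (x x′ : Mon a) (z z′ : Mon b) → z′ ∣ₘ z → (x V.++ z) <lex (x′ V.++ z′) → z ≡ z′
  <lex-highBlock x x′ z z′ z′∣z lt
    with LexLt-++⁻ (lexKey z) (lexKey z′) (trans (length-lexKey z) (sym (length-lexKey z′)))
           (subst₂ LexLt (lexKey-++ x z) (lexKey-++ x′ z′) lt)
  ... | inj₁ z<z′      = ⊥-elim (∣ₘ⇒≯ z′∣z z<z′)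
  ... | inj₂ (eq , _)  = lexKey-injective z z′ eq

  ∣ₘ-fromLookup : ∀ {n} (e f : Mon n) → (∀ v → V.lookup e v ≤ V.lookup f v) → e ∣ₘ f
  ∣ₘ-fromLookup []      []      _  = VPW.[]
  ∣ₘ-fromLookup (a ∷ e) (b ∷ f) le = le F.zero VPW.∷ ∣ₘ-fromLookup e f (λ v → le (F.suc v))

  zeros-∣ₘ : ∀ {n} (e : Mon n) → V.replicate n 0 ∣ₘ e
  zeros-∣ₘ []      = VPW.[]
  zeros-∣ₘ (a ∷ e) = ℕ.z≤n VPW.∷ zeros-∣ₘ e

  lookup-unit-same : ∀ {N} (v : Fin N) a → V.lookup (unitMon v a) v ≡ a
  lookup-unit-same F.zero    a = refl
  lookup-unit-same (F.suc v) a = lookup-unit-same v a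

  lookup-unit-other : ∀ {N} (v w : Fin N) a → w ≢ v → V.lookup (unitMon v a) w ≡ 0
  lookup-unit-other F.zero    F.zero    a w≢v = ⊥-elim (w≢v refl)
  lookup-unit-other F.zero    (F.suc w) a _   = VP.lookup-replicate w 0
  lookup-unit-other (F.suc v) F.zero    a _   = refl
  lookup-unit-other (F.suc v) (F.suc w) a w≢v = lookup-unit-other v w a (λ eq → w≢v (cong F.suc eq))

  unit-∣ₘ : ∀ {N} (v : Fin N) a (f : Mon N) → a ≤ V.lookup f v → unitMon v a ∣ₘ f
  unit-∣ₘ v a f a≤ = ∣ₘ-fromLookup _ f exponent≤
    where
    exponent≤ : ∀ w → V.lookup (unitMon v a) w ≤ V.lookup f w
    exponent≤ w with w FP.≟ v
    ... | yes refl = subst (_≤ V.lookup f w) (sym (lookup-unit-same v a)) a≤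
    ... | no w≢v   = subst (_≤ V.lookup f w) (sym (lookup-unit-other v w a w≢v)) ℕ.z≤n

  unit-∣ₘ⁻ : ∀ {N} (v : Fin N) a (f : Mon N) → unitMon v a ∣ₘ f → a ≤ V.lookup f v
  unit-∣ₘ⁻ v a f u∣f = subst (_≤ V.lookup f v) (lookup-unit-same v a) (VPW.lookup u∣f v)

  unit-↑ʳ : ∀ k {m} (j : Fin m) a → unitMon (k F.↑ʳ j) a ≡ V.replicate k 0 V.++ unitMon j a
  unit-↑ʳ zero    j a = refl
  unit-↑ʳ (suc k) j a = cong (0 ∷_) (unit-↑ʳ k j a)


module ConcatIndex {a} {A : Set a} where
  tabulateIndex : ∀ {m} (g : Fin m → A) → Fin (L.length (L.tabulate g)) → Fin m
  tabulateIndex {suc m} g F.zero    = F.zero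
  tabulateIndex {suc m} g (F.suc i) = F.suc (tabulateIndex (λ j → g (F.suc j)) i)

  lookup-tabulateIndex : ∀ {m} (g : Fin m → A) i → L.lookup (L.tabulate g) i ≡ g (tabulateIndex g i)
  lookup-tabulateIndex {suc m} g F.zero    = refl
  lookup-tabulateIndex {suc m} g (F.suc i) = lookup-tabulateIndex (λ j → g (F.suc j)) i

  tabulateIndex-injective : ∀ {m} (g : Fin m → A) i j → tabulateIndex g i ≡ tabulateIndex g j → i ≡ j
  tabulateIndex-injective {suc m} g F.zero    F.zero    _  = refl
  tabulateIndex-injective {suc m} g (F.suc i) (F.suc j) eq =
    cong F.suc (tabulateIndex-injective (λ j → g (F.suc j)) i j (FP.suc-injective eq))

  position : ∀ {n m} (f : Fin n → A) (g : Fin m → A) → Fin (L.length (L.tabulate f L.++ L.tabulate g)) → Fin n ⊎ Fin m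
  position {zero}  f g i         = inj₂ (tabulateIndex g i)
  position {suc n} f g F.zero    = inj₁ F.zero
  position {suc n} f g (F.suc i) = Sum.map₁ F.suc (position (λ j → f (F.suc j)) g i)

  lookup-position : ∀ {n m} (f : Fin n → A) (g : Fin m → A) i →
                    L.lookup (L.tabulate f L.++ L.tabulate g) i ≡ [ f , g ] (position f g i)
  lookup-position {zero}  f g i         = lookup-tabulateIndex g i
  lookup-position {suc n} f g F.zero    = refl
  lookup-position {suc n} f g (F.suc i) with position (λ j → f (F.suc j)) g i | lookup-position (λ j → f (F.suc j)) g i
  ... | inj₁ _ | eq = eq
  ... | inj₂ _ | eq = eq

  private
    map₁-suc-injective : ∀ {n m} (x y : Fin n ⊎ Fin m) → Sum.map₁ F.suc x ≡ Sum.map₁ F.suc y → x ≡ y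
    map₁-suc-injective (inj₁ x) (inj₁ y) eq = cong inj₁ (FP.suc-injective (SumP.inj₁-injective eq))
    map₁-suc-injective (inj₂ x) (inj₂ y) eq = cong inj₂ (SumP.inj₂-injective eq)

    map₁-suc≢zero : ∀ {n m} (x : Fin n ⊎ Fin m) → Sum.map₁ F.suc x ≢ inj₁ F.zero
    map₁-suc≢zero (inj₁ x) ()
    map₁-suc≢zero (inj₂ y) ()

  position-injective : ∀ {n m} (f : Fin n → A) (g : Fin m → A) i j → position f g i ≡ position f g j → i ≡ j
  position-injective {zero}  f g i j eq = tabulateIndex-injective g i j (SumP.inj₂-injective eq)
  position-injective {suc n} f g F.zero    F.zero    eq = refl
  position-injective {suc n} f g F.zero    (F.suc j) eq = ⊥-elim (map₁-suc≢zero (position (λ j → f (F.suc j)) g j) (sym eq))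
  position-injective {suc n} f g (F.suc i) F.zero    eq = ⊥-elim (map₁-suc≢zero (position (λ j → f (F.suc j)) g i) eq)
  position-injective {suc n} f g (F.suc i) (F.suc j) eq =
    cong F.suc (position-injective _ g i j (map₁-suc-injective (position (λ j → f (F.suc j)) g i) _ eq))


module MonomialEvaluation {c} (K : Field c) where
  open Field K
  open Poly K
  open FieldArithmetic K

  evalMon-zeros : ∀ {n} (y : Vec Carrier n) → evalMon (V.replicate n 0) y ≡ 1#
  evalMon-zeros []       = refl
  evalMon-zeros (y ∷ ys) = trans (*-identityˡ _) (evalMon-zeros ys)

  evalMon-unit : ∀ {N} (v : Fin N) a (y : Vec Carrier N) → evalMon (unitMon v a) y ≡ V.lookup y v ^ a
  evalMon-unit F.zero    a (y ∷ ys) = trans (cong (y ^ a *_) (evalMon-zeros ys)) (*-identityʳ _)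
  evalMon-unit (F.suc v) a (y ∷ ys) = trans (*-identityˡ _) (evalMon-unit v a ys)

  evalMon-pad : ∀ {n m} (e : Mon n) (x : Vec Carrier n) (z : Vec Carrier m) →
                evalMon (e V.++ V.replicate m 0) (x V.++ z) ≡ evalMon e x
  evalMon-pad []      []       z = evalMon-zeros z
  evalMon-pad (d ∷ e) (x ∷ xs) z = cong (x ^ d *_) (evalMon-pad e xs z)

lookup-extensional : ∀ {a} {A : Set a} {n} (u v : Vec A n) → (∀ i → V.lookup u i ≡ V.lookup v i) → u ≡ v
lookup-extensional u v same = trans (sym (VP.tabulate∘lookup u)) (trans (VP.tabulate-cong same) (VP.tabulate∘lookup v))

module Blocks {a} {A : Set a} (k m : ℕ) where
  low : Vec A (k ℕ.+ m) → Vec A k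
  low = V.take k

  high : Vec A (k ℕ.+ m) → Vec A m
  high = V.drop k

  low-high : ∀ y → low y V.++ high y ≡ y
  low-high = VP.take++drop≡id k

  low-++ : ∀ (x : Vec A k) (z : Vec A m) → low (x V.++ z) ≡ x
  low-++ x z = VP.++-injectiveˡ (low (x V.++ z)) x (low-high (x V.++ z))

  high-++ : ∀ (x : Vec A k) (z : Vec A m) → high (x V.++ z) ≡ z
  high-++ x z = VP.++-injectiveʳ (low (x V.++ z)) x (low-high (x V.++ z))

  lookup-low : ∀ y i → V.lookup (low y) i ≡ V.lookup y (i F.↑ˡ m)
  lookup-low y i = trans (sym (VP.lookup-++ˡ (low y) (high y) i)) (cong (λ y → V.lookup y (i F.↑ˡ m)) (low-high y))

  lookup-high : ∀ y j → V.lookup (high y) j ≡ V.lookup y (k F.↑ʳ j)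
  lookup-high y j = trans (sym (VP.lookup-++ʳ (low y) (high y) j)) (cong (λ y → V.lookup y (k F.↑ʳ j)) (low-high y))

module GraphCode {c} (K : Field c) (r : ℕ) (E : Fin (suc (suc r)) ↔ Field.Carrier K)
       (k m : ℕ) (F : Fin m → Vec (Field.Carrier K) k → Field.Carrier K) (P : Fin m → Poly.Pol K k)
       (P-reduced : ∀ j → Poly.DegLt K (suc (suc r)) (P j) × Poly.Represents K (P j) (F j)) where
  open Field K
  open Poly K
  open FieldArithmetic K
  open FiniteField K r E
  open ≡-Reasoning

  G : List (Pol (k ℕ.+ m))
  G = GSet k m q P

  pad : Mon k → Mon (k ℕ.+ m)
  pad e = e V.++ V.replicate m 0

  zMon : Fin m → Mon (k ℕ.+ m)
  zMon j = unitMon (k F.↑ʳ j) 1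

  negPad : Pol k → Pol (k ℕ.+ m)
  negPad = L.map (λ term → (- proj₁ term , pad (proj₂ term)))

  open MonomialEvaluation K
  open Blocks {A = Carrier} k m

  eval-negPad : ∀ Q x z → eval (negPad Q) (x V.++ z) ≡ - eval Q x
  eval-negPad []            x z = sym -0#≡0#
  eval-negPad ((a , e) ∷ Q) x z = begin
    - a * evalMon (pad e) (x V.++ z) + eval (negPad Q) (x V.++ z)
      ≡⟨ cong₂ _+_ (trans (-*-comm a _) (cong (λ t → - (a * t)) (evalMon-pad e x z))) (eval-negPad Q x z) ⟩
    - (a * evalMon e x) + - eval Q x    ≡⟨ -‿+-comm _ _ ⟩
    - (a * evalMon e x + eval Q x)      ∎

  eval-xPoly : ∀ i y → eval (xPoly k m q i) y ≡ 0#
  eval-xPoly i y = begin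
    1# * evalMon (unitMon v q) y + (- 1# * evalMon (unitMon v 1) y + 0#)
      ≡⟨ cong₂ _+_ (trans (*-identityˡ _) (evalMon-unit v q y))
                   (trans (+-identityʳ _) (trans (-*-comm 1# _) (cong -_ (trans (*-identityˡ _)
                     (trans (evalMon-unit v 1 y) (*-identityʳ _)))))) ⟩
    t ^ q - t   ≡⟨ cong (_- t) (fermat t) ⟩
    t - t       ≡⟨ x-x≡0 t ⟩
    0#          ∎
    where
    v = i F.↑ˡ m
    t = V.lookup y v

  eval-zPoly : ∀ j Q x z → eval (zPoly k m j Q) (x V.++ z) ≡ V.lookup z j - eval Q x
  eval-zPoly j Q x z = cong₂ _+_ z-term (eval-negPad Q x z)
    where
    z-term : 1# * evalMon (zMon j) (x V.++ z) ≡ V.lookup z j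
    z-term = trans (*-identityˡ _) (trans (evalMon-unit (k F.↑ʳ j) 1 (x V.++ z))
               (trans (*-identityʳ _) (VP.lookup-++ʳ x z j)))

  G-member : ∀ {g} → g ∈ G → (∃ λ i → g ≡ xPoly k m q i) ⊎ (∃ λ j → g ≡ zPoly k m j (P j))
  G-member g∈G = Sum.map MP.∈-tabulate⁻ MP.∈-tabulate⁻ (MP.∈-++⁻ (L.tabulate (xPoly k m q)) g∈G)

  xPoly∈G : ∀ i → xPoly k m q i ∈ G
  xPoly∈G i = MP.∈-++⁺ˡ (MP.∈-tabulate⁺ i)

  zPoly∈G : ∀ j → zPoly k m j (P j) ∈ G
  zPoly∈G j = MP.∈-++⁺ʳ (L.tabulate (xPoly k m q)) (MP.∈-tabulate⁺ j)

  graph : Vec Carrier k → Vec Carrier (k ℕ.+ m)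
  graph x = x V.++ V.tabulate (λ j → F j x)

  lookup-graph : ∀ x j → V.lookup (graph x) (k F.↑ʳ j) ≡ F j x
  lookup-graph x j = trans (VP.lookup-++ʳ x _ j) (VP.lookup∘tabulate _ j)

  graph-injective : ∀ x x′ → graph x ≡ graph x′ → x ≡ x′
  graph-injective x x′ = VP.++-injectiveˡ x x′

  graph∈ZeroSet : ∀ x → ZeroSet G (graph x)
  graph∈ZeroSet x g∈G with G-member g∈G
  ... | inj₁ (i , refl) = eval-xPoly i (graph x)
  ... | inj₂ (j , refl) = begin
    eval (zPoly k m j (P j)) (graph x)                  ≡⟨ eval-zPoly j (P j) x _ ⟩
    V.lookup (V.tabulate (λ j → F j x)) j - eval (P j) x ≡⟨ cong₂ _-_ (VP.lookup∘tabulate _ j) (proj₂ (P-reduced j) x) ⟩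
    F j x - F j x                                       ≡⟨ x-x≡0 _ ⟩
    0#                                                  ∎

  ZeroSet⇒graph : ∀ y → ZeroSet G y → y ≡ graph (low y)
  ZeroSet⇒graph y y∈Z = trans (sym (low-high y)) (cong (low y V.++_) high≡F)
    where
    z-coordinate : ∀ j → V.lookup (high y) j ≡ F j (low y)
    z-coordinate j = trans (x-y≡0⇒x≡y _ _ (begin
        V.lookup (high y) j - eval (P j) (low y)   ≡⟨ sym (eval-zPoly j (P j) (low y) (high y)) ⟩
        eval (zPoly k m j (P j)) (low y V.++ high y) ≡⟨ cong (eval (zPoly k m j (P j))) (low-high y) ⟩
        eval (zPoly k m j (P j)) y                 ≡⟨ y∈Z (zPoly∈G j) ⟩
        0#                                         ∎))
      (proj₂ (P-reduced j) (low y))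
    high≡F : high y ≡ V.tabulate (λ j → F j (low y))
    high≡F = trans (sym (VP.tabulate∘lookup (high y))) (VP.tabulate-cong z-coordinate)

  ZeroSet⇔graph : ∀ y → ZeroSet G y ⇔ (∃[ x ] graph x ≡ y)
  ZeroSet⇔graph y = mk⇔ (λ (y∈Z : ZeroSet G y) → low y , sym (ZeroSet⇒graph y y∈Z)) (λ { (x , refl) → graph∈ZeroSet x })

  systematic : IsSystematicCode k m (ZeroSet G)
  systematic = graph , (λ {x} {x′} → graph-injective x x′) , (λ x → low-++ x _) , ZeroSet⇔graph


module LeadingMonomials {c} (K : Field c) (r : ℕ) (E : Fin (suc (suc r)) ↔ Field.Carrier K)
       (k m : ℕ) (F : Fin m → Vec (Field.Carrier K) k → Field.Carrier K) (P : Fin m → Poly.Pol K k)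
       (P-reduced : ∀ j → Poly.DegLt K (suc (suc r)) (P j) × Poly.Represents K (P j) (F j)) where
  open Field K
  open Poly K
  open FieldArithmetic K
  open LinearFunctionals K
  open FiniteField K r E
  open MonomialOrder K
  open Blocks {A = ℕ} k m
  open GraphCode K r E k m F P P-reduced using (G; pad; zMon; negPad; xPoly∈G; zPoly∈G; G-member)
  open ≡-Reasoning

  zeros : ∀ n → Mon n
  zeros n = V.replicate n 0

  generator : Fin k ⊎ Fin m → Pol (k ℕ.+ m)
  generator = [ xPoly k m q , (λ j → zPoly k m j (P j)) ]

  leadVar : Fin k ⊎ Fin m → Fin (k ℕ.+ m)
  leadVar = [ (λ i → i F.↑ˡ m) , (λ j → k F.↑ʳ j) ]

  leadExp : Fin k ⊎ Fin m → ℕ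
  leadExp = [ (λ _ → q) , (λ _ → 1) ]

  leadMon : Fin k ⊎ Fin m → Mon (k ℕ.+ m)
  leadMon s = unitMon (leadVar s) (leadExp s)

  leadExp-positive : ∀ s → 0 ℕ.< leadExp s
  leadExp-positive (inj₁ _) = ℕ.s≤s ℕ.z≤n
  leadExp-positive (inj₂ _) = ℕ.s≤s ℕ.z≤n

  leadVar-injective : ∀ s t → leadVar s ≡ leadVar t → s ≡ t
  leadVar-injective (inj₁ i) (inj₁ i′) eq = cong inj₁ (FP.↑ˡ-injective m i i′ eq)
  leadVar-injective (inj₂ j) (inj₂ j′) eq = cong inj₂ (FP.↑ʳ-injective k j j′ eq)
  leadVar-injective (inj₁ i) (inj₂ j)  eq = ⊥-elim (ℕP.<⇒≢ (ℕP.<-≤-trans low<k k≤high) (cong F.toℕ eq))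
    where
    low<k : F.toℕ (i F.↑ˡ m) ℕ.< k
    low<k = subst (ℕ._< k) (sym (FP.toℕ-↑ˡ i m)) (FP.toℕ<n i)
    k≤high : k ≤ F.toℕ (k F.↑ʳ j)
    k≤high = subst (k ≤_) (sym (FP.toℕ-↑ʳ k j)) (ℕP.m≤m+n k (F.toℕ j))
  leadVar-injective (inj₂ j) (inj₁ i)  eq = sym (leadVar-injective (inj₁ i) (inj₂ j) (sym eq))

  unit-outside : ∀ s t a → s ≢ t → V.lookup (unitMon (leadVar s) a) (leadVar t) ℕ.< leadExp t
  unit-outside s t a s≢t = subst (ℕ._< leadExp t)
    (sym (lookup-unit-other (leadVar s) (leadVar t) a (λ eq → s≢t (leadVar-injective s t (sym eq)))))
    (leadExp-positive t)

  unit-≢ : ∀ {N} (v : Fin N) a b → a ≢ b → unitMon v a ≢ unitMon v b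
  unit-≢ v a b a≢b eq = a≢b (trans (sym (lookup-unit-same v a)) (trans (cong (λ e → V.lookup e v) eq) (lookup-unit-same v b)))

  support-xPoly : ∀ i e → coeff (xPoly k m q i) e ≢ 0# → e ≡ unitMon (i F.↑ˡ m) q ⊎ e ≡ unitMon (i F.↑ˡ m) 1
  support-xPoly i e c≢0 = cases (unitMon (i F.↑ˡ m) q ≟ₘ e) (unitMon (i F.↑ˡ m) 1 ≟ₘ e)
    where
    cases : Dec (unitMon (i F.↑ˡ m) q ≡ e) → Dec (unitMon (i F.↑ˡ m) 1 ≡ e) →
            e ≡ unitMon (i F.↑ˡ m) q ⊎ e ≡ unitMon (i F.↑ˡ m) 1
    cases (yes eq) _        = inj₁ (sym eq)
    cases (no _)   (yes eq) = inj₂ (sym eq)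
    cases (no ne)  (no ne′) = ⊥-elim (c≢0 (trans (coeff-skip 1# _ e _ ne) (coeff-skip (- 1#) _ e [] ne′)))

  pad-low : ∀ e → high e ≡ zeros m → pad (low e) ≡ e
  pad-low e high≡0 = trans (cong (low e V.++_) (sym high≡0)) (low-high e)

  high-pad : ∀ e → high (pad e) ≡ zeros m
  high-pad e = high-++ e (zeros m)

  coeff-negPad : ∀ Q e → coeff (negPad Q) e ≡ lin (λ e′ → δₘ (pad e′) e) (negate Q)
  coeff-negPad Q e = trans (cong (λ p → coeff p e) (LP.map-∘ Q)) (coeff-mapMon pad (negate Q) e)

  coeff-negPad-pad : ∀ Q e → coeff (negPad Q) (pad e) ≡ - coeff Q e
  coeff-negPad-pad Q e = begin
    coeff (negPad Q) (pad e)                    ≡⟨ coeff-negPad Q (pad e) ⟩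
    lin (λ e′ → δₘ (pad e′) (pad e)) (negate Q) ≡⟨ lin-cong-support _ _ (negate Q) (λ e′ → inj₂ (δ-pad e′)) ⟩
    lin (λ e′ → δₘ e′ e) (negate Q)             ≡⟨ sym (coeff≡lin (negate Q) e) ⟩
    coeff (negate Q) e                          ≡⟨ coeff-negate Q e ⟩
    - coeff Q e                                 ∎
    where
    δ-pad : ∀ e′ → δₘ (pad e′) (pad e) ≡ δₘ e′ e
    δ-pad e′ = cases (e′ ≟ₘ e)
      where
      cases : Dec (e′ ≡ e) → δₘ (pad e′) (pad e) ≡ δₘ e′ e
      cases (yes refl) = trans (δₘ-≡ (pad e′)) (sym (δₘ-≡ e′))
      cases (no e′≢e)  = trans (δₘ-≢ (λ eq → e′≢e (VP.++-injectiveˡ e′ e eq))) (sym (δₘ-≢ e′≢e))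

  coeff-negPad-nonpad : ∀ Q e → high e ≢ zeros m → coeff (negPad Q) e ≡ 0#
  coeff-negPad-nonpad Q e high≢0 = begin
    coeff (negPad Q) e                     ≡⟨ coeff-negPad Q e ⟩
    lin (λ e′ → δₘ (pad e′) e) (negate Q)  ≡⟨ lin-cong-support _ _ (negate Q) (λ e′ → inj₂ (δₘ-≢ (pad≢ e′))) ⟩
    lin (λ _ → 0#) (negate Q)              ≡⟨ lin-zero (negate Q) ⟩
    0#                                     ∎
    where
    pad≢ : ∀ e′ → pad e′ ≢ e
    pad≢ e′ eq = high≢0 (trans (cong high (sym eq)) (high-pad e′))

  support-zPoly : ∀ j e → coeff (zPoly k m j (P j)) e ≢ 0# →
                  e ≡ zMon j ⊎ ∃ λ e′ → e ≡ pad e′ × coeff (P j) e′ ≢ 0#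
  support-zPoly j e c≢0 = cases (zMon j ≟ₘ e) (high e ≟ₘ zeros m)
    where
    cases : Dec (zMon j ≡ e) → Dec (high e ≡ zeros m) → e ≡ zMon j ⊎ ∃ λ e′ → e ≡ pad e′ × coeff (P j) e′ ≢ 0#
    cases (yes eq)  _            = inj₁ (sym eq)
    cases (no z≢e)  (yes high≡0) = inj₂ (low e , sym (pad-low e high≡0) , λ c′≡0 → c≢0 (begin
      coeff (zPoly k m j (P j)) e              ≡⟨ coeff-skip 1# (zMon j) e _ z≢e ⟩
      coeff (negPad (P j)) e                   ≡⟨ cong (coeff (negPad (P j))) (sym (pad-low e high≡0)) ⟩
      coeff (negPad (P j)) (pad (low e))       ≡⟨ coeff-negPad-pad (P j) (low e) ⟩
      - coeff (P j) (low e)                    ≡⟨ cong -_ c′≡0 ⟩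
      - 0#                                     ≡⟨ -0#≡0# ⟩
      0#                                       ∎))
    cases (no z≢e)  (no high≢0)  = ⊥-elim (c≢0 (trans (coeff-skip 1# (zMon j) e _ z≢e) (coeff-negPad-nonpad (P j) e high≢0)))

  zMon-blocks : ∀ j → zMon j ≡ zeros k V.++ unitMon j 1
  zMon-blocks j = unit-↑ʳ k j 1

  zMon-nonpad : ∀ j → high (zMon j) ≢ zeros m
  zMon-nonpad j eq = unit-≢ j 1 0 (λ ()) (trans (sym (high-++ (zeros k) (unitMon j 1)))
    (trans (cong high (sym (zMon-blocks j))) (trans eq (sym (unit₀≡zeros j)))))
    where
    unit₀≡zeros : ∀ {n} (j : Fin n) → unitMon j 0 ≡ zeros n
    unit₀≡zeros {suc n} F.zero    = refl
    unit₀≡zeros {suc n} (F.suc j) = cong (0 ∷_) (unit₀≡zeros j)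

  coeff-lead : ∀ s → coeff (generator s) (leadMon s) ≡ 1#
  coeff-lead (inj₁ i) = begin
    coeff (xPoly k m q i) (unitMon v q)      ≡⟨ coeff-head 1# (unitMon v q) _ ⟩
    1# + coeff ((- 1# , unitMon v 1) ∷ []) (unitMon v q)
      ≡⟨ cong (1# +_) (coeff-skip (- 1#) _ _ [] (unit-≢ v 1 q (λ ()))) ⟩
    1# + 0#                                  ≡⟨ +-identityʳ 1# ⟩
    1#                                       ∎
    where v = i F.↑ˡ m
  coeff-lead (inj₂ j) = begin
    coeff (zPoly k m j (P j)) (zMon j)       ≡⟨ coeff-head 1# (zMon j) _ ⟩
    1# + coeff (negPad (P j)) (zMon j)       ≡⟨ cong (1# +_) (coeff-negPad-nonpad (P j) (zMon j) (zMon-nonpad j)) ⟩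
    1# + 0#                                  ≡⟨ +-identityʳ 1# ⟩
    1#                                       ∎

  below-lead : ∀ s e → coeff (generator s) e ≢ 0# → e ≡ leadMon s ⊎ e <lex leadMon s
  below-lead (inj₁ i) e c≢0 with support-xPoly i e c≢0
  ... | inj₁ e≡lead = inj₁ e≡lead
  ... | inj₂ refl   = inj₂ (∣ₘ∧≢⇒< (unit-∣ₘ v 1 _ (subst (1 ≤_) (sym (lookup-unit-same v q)) (ℕ.s≤s ℕ.z≤n)))
                                   (unit-≢ v 1 q (λ ())))
    where v = i F.↑ˡ m
  below-lead (inj₂ j) e c≢0 with support-zPoly j e c≢0
  ... | inj₁ e≡lead        = inj₁ e≡lead
  ... | inj₂ (e′ , refl , _) = inj₂ (subst (pad e′ <lex_) (sym (zMon-blocks j))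
          (<lex-byHigh e′ (zeros k) (zeros m) (unitMon j 1) (zeros-∣ₘ _) (λ eq → zMon-nonpad j
            (trans (cong high (zMon-blocks j)) (trans (high-++ (zeros k) (unitMon j 1)) (sym eq))))))

  generator-LM : ∀ s → IsLM (generator s) (leadMon s)
  generator-LM s = (λ c≡0 → 1#≢0# (trans (sym (coeff-lead s)) c≡0)) , below-lead s

  monic : ∀ {g} → g ∈ G → ∃[ mg ] (IsLM g mg × coeff g mg ≡ 1#)
  monic g∈G with G-member g∈G
  ... | inj₁ (i , refl) = leadMon (inj₁ i) , generator-LM (inj₁ i) , coeff-lead (inj₁ i)
  ... | inj₂ (j , refl) = leadMon (inj₂ j) , generator-LM (inj₂ j) , coeff-lead (inj₂ j)

  support-outside : ∀ s t e → s ≢ t → coeff (generator s) e ≢ 0# → V.lookup e (leadVar t) ℕ.< leadExp t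
  support-outside (inj₁ i) t e s≢t c≢0 with support-xPoly i e c≢0
  ... | inj₁ refl = unit-outside (inj₁ i) t q s≢t
  ... | inj₂ refl = unit-outside (inj₁ i) t 1 s≢t
  support-outside (inj₂ j) t e s≢t c≢0 with support-zPoly j e c≢0
  ... | inj₁ refl = unit-outside (inj₂ j) t 1 s≢t
  ... | inj₂ (e′ , refl , c′≢0) = pad-outside t
    where
    pad-outside : ∀ t → V.lookup (pad e′) (leadVar t) ℕ.< leadExp t
    pad-outside (inj₁ i)  = subst (ℕ._< q) (sym (VP.lookup-++ˡ e′ (zeros m) i))
                              (VAP.lookup⁺ (proj₁ (P-reduced j) e′ c′≢0) i)
    pad-outside (inj₂ j′) = subst (ℕ._< 1) (sym (trans (VP.lookup-++ʳ e′ (zeros m) j′) (VP.lookup-replicate j′ 0)))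
                              (ℕ.s≤s ℕ.z≤n)

  open ConcatIndex

  reduced : ∀ (i j : Fin (L.length G)) → i ≢ j → ∀ mj e →
            IsLM (L.lookup G j) mj → coeff (L.lookup G i) e ≢ 0# → ¬ (mj ∣ₘ e)
  reduced i j i≢j mj e lm c≢0 mj∣e =
    ℕP.<⇒≱ (support-outside s t e s≢t c′≢0) (unit-∣ₘ⁻ (leadVar t) (leadExp t) e (subst (_∣ₘ e) mj≡lead mj∣e))
    where
    s = position (xPoly k m q) (λ j → zPoly k m j (P j)) i
    t = position (xPoly k m q) (λ j → zPoly k m j (P j)) j
    s≢t : s ≢ t
    s≢t eq = i≢j (position-injective (xPoly k m q) _ i j eq)
    mj≡lead : mj ≡ leadMon t
    mj≡lead = IsLM-unique {p = generator t} (subst (λ g → IsLM g mj) (lookup-position (xPoly k m q) _ j) lm) (generator-LM t)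
    c′≢0 : coeff (generator s) e ≢ 0#
    c′≢0 c≡0 = c≢0 (trans (cong (λ g → coeff g e) (lookup-position (xPoly k m q) _ i)) c≡0)
-- Otherwise it is a standard monomial
-- x^a with all a_i < q; since the z-variables dominate the lex order, all
-- monomials of f then avoid z, and reducing exponents turns f into a reduced
-- polynomial in x that vanishes on K^k (f vanishes on the graph) and still has
-- the nonzero coefficient of f at x^a, contradicting uniqueness.
module VanishingLeadingTerms {c} (K : Field c) (r : ℕ) (E : Fin (suc (suc r)) ↔ Field.Carrier K)
       (k m : ℕ) (F : Fin m → Vec (Field.Carrier K) k → Field.Carrier K) (P : Fin m → Poly.Pol K k)
       (P-reduced : ∀ j → Poly.DegLt K (suc (suc r)) (P j) × Poly.Represents K (P j) (F j)) where
  open Field K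
  open Poly K
  open LinearFunctionals K
  open FiniteField K r E
  open MonomialOrder K
  open MonomialEvaluation K
  open ExponentReduction K r E
  open ReducedUniqueness K r E using (reduced-zero)
  open Interpolation K r E using (TermsBelow; TermsBelow⇒DegLt)
  open Blocks {A = ℕ} k m
  open GraphCode K r E k m F P P-reduced using (G; pad; graph; graph∈ZeroSet; xPoly∈G; zPoly∈G)
  open LeadingMonomials K r E k m F P P-reduced using (zeros; leadMon; generator-LM; pad-low)
  open ≡-Reasoning

  HighZero : Mon (k ℕ.+ m) → Set
  HighZero e = high e ≡ zeros m

  xPart : Pol (k ℕ.+ m) → Pol (k ℕ.+ m)
  xPart = restrict (λ e → high e ≟ₘ zeros m)

  project : Pol (k ℕ.+ m) → Pol k
  project = mapMon (λ e → V.map reduceExp (low e))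

  project-reduced : ∀ g → DegLt q (project g)
  project-reduced g = TermsBelow⇒DegLt (project g) (terms g)
    where
    terms : ∀ g → TermsBelow (project g)
    terms []            = []ᴸ
    terms ((a , e) ∷ g) = reduceExp-all<q (low e) ∷ᴸ terms g

  eval-project : ∀ g → LA.All (λ term → HighZero (proj₂ term)) g → ∀ x → eval (project g) x ≡ eval g (graph x)
  eval-project []            []ᴸ               x = refl
  eval-project ((a , e) ∷ g) (high≡0 ∷ᴸ highs≡0) x = cong₂ _+_ (cong (a *_) monomial) (eval-project g highs≡0 x)
    where
    monomial : evalMon (V.map reduceExp (low e)) x ≡ evalMon e (graph x)
    monomial = begin
      evalMon (V.map reduceExp (low e)) x   ≡⟨ evalMon-reduceExp (low e) x ⟩
      evalMon (low e) x                     ≡⟨ sym (evalMon-pad (low e) x _) ⟩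
      evalMon (pad (low e)) (graph x)       ≡⟨ cong (λ e → evalMon e (graph x)) (pad-low e high≡0) ⟩
      evalMon e (graph x)                   ∎

  standard-not-leading : ∀ f mf → Vanishing (ZeroSet G) f → IsLM f mf →
                         (∀ i → V.lookup mf (i F.↑ˡ m) ℕ.< q) → (∀ j → V.lookup mf (k F.↑ʳ j) ≡ 0) → ⊥
  standard-not-leading f mf vanishes (cf≢0 , below) x-small z-zero = cf≢0 (begin
    coeff f mf                                            ≡⟨ sym (coeff-xPart mf) ⟩
    coeff (xPart f) mf                                    ≡⟨ coeff≡lin (xPart f) mf ⟩
    lin (λ e → δₘ e mf) (xPart f)                         ≡⟨ lin-cong-support (λ e → δₘ e mf) _ (xPart f) same-weights ⟩
    lin (λ e → δₘ (V.map reduceExp (low e)) (low mf)) (xPart f)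
                                                          ≡⟨ sym (coeff-mapMon _ (xPart f) (low mf)) ⟩
    coeff (project (xPart f)) (low mf)                    ≡⟨ reduced-zero k (project (xPart f)) (project-reduced (xPart f)) project≡0 (low mf) ⟩
    0#                                                    ∎)
    where
    high-mf : HighZero mf
    high-mf = lookup-extensional (high mf) (zeros m)
                (λ j → trans (lookup-high mf j) (trans (z-zero j) (sym (VP.lookup-replicate j 0))))
    low-mf-small : All (ℕ._< q) (low mf)
    low-mf-small = VAP.lookup⁻ (λ i → subst (ℕ._< q) (sym (lookup-low mf i)) (x-small i))
    mf≡ : mf ≡ low mf V.++ zeros m
    mf≡ = trans (sym (low-high mf)) (cong (low mf V.++_) high-mf)

    -- monomials below mf avoid z, as z dominates the order
    support-highZero : ∀ e → coeff f e ≢ 0# → HighZero e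
    support-highZero e c≢0 with below e c≢0
    ... | inj₁ refl = high-mf
    ... | inj₂ e<mf = <lex-highBlock (low e) (low mf) (high e) (zeros m) (zeros-∣ₘ (high e))
                        (subst₂ _<lex_ (sym (low-high e)) mf≡ e<mf)

    coeff-xPart : ∀ e → coeff (xPart f) e ≡ coeff f e
    coeff-xPart e with high e ≟ₘ zeros m
    ... | yes high≡0 = coeff-restrict-in _ f e high≡0
    ... | no high≢0  = trans (coeff-restrict-out _ f e high≢0)
                             (sym (≡-stable (λ c≢0 → high≢0 (support-highZero e c≢0))))

    project≡0 : ∀ x → eval (project (xPart f)) x ≡ 0#
    project≡0 x = begin
      eval (project (xPart f)) x    ≡⟨ eval-project (xPart f) (restrict-satisfies _ f) x ⟩
      eval (xPart f) (graph x)      ≡⟨ eval-cong-coeff (xPart f) f coeff-xPart (graph x) ⟩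
      eval f (graph x)              ≡⟨ vanishes (graph x) (graph∈ZeroSet x) ⟩
      0#                            ∎

    -- no other monomial of f reduces to the x-part of mf: it would be divisible by mf
    weights-agree : ∀ e → coeff f e ≢ 0# → δₘ e mf ≡ δₘ (V.map reduceExp (low e)) (low mf)
    weights-agree e c≢0 with below e c≢0
    ... | inj₁ refl = trans (δₘ-≡ mf) (sym (trans (cong (λ e′ → δₘ e′ (low mf)) (reduceExp-small-mon (low mf) low-mf-small))
                                                 (δₘ-≡ (low mf))))
    ... | inj₂ e<mf = trans (δₘ-≢ {e = e} {mf} (λ { refl → LexLt-irrefl e<mf })) (sym (δₘ-≢ reduced≢))
      where
      reduced≢ : V.map reduceExp (low e) ≢ low mf
      reduced≢ eq = ∣ₘ⇒≯ mf∣e e<mf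
        where
        mf∣e : mf ∣ₘ e
        mf∣e = subst₂ _∣ₘ_ (sym mf≡) (trans (cong (low e V.++_) (sym (support-highZero e c≢0))) (low-high e))
                 (VPW.++⁺ (subst (_∣ₘ low e) eq (reduceExp-divides (low e))) (VPW.refl ℕP.≤-refl))

    same-weights : ∀ e → coeff (xPart f) e ≡ 0# ⊎ δₘ e mf ≡ δₘ (V.map reduceExp (low e)) (low mf)
    same-weights e with coeff (xPart f) e ≟ 0#
    ... | yes c≡0 = inj₁ c≡0
    ... | no c≢0  = inj₂ (weights-agree e (λ c≡0 → c≢0 (trans (coeff-xPart e) c≡0)))

  leading-divisible : ∀ f mf → Vanishing (ZeroSet G) f → IsLM f mf →
                      ∃[ g ] ∃[ mg ] (g ∈ G × IsLM g mg × mg ∣ₘ mf)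
  leading-divisible f mf vanishes lm with FP.any? (λ i → q ℕ.≤? V.lookup mf (i F.↑ˡ m))
  ... | yes (i , q≤) = xPoly k m q i , leadMon (inj₁ i) , xPoly∈G i , generator-LM (inj₁ i) , unit-∣ₘ _ q mf q≤
  ... | no no-x with FP.any? (λ j → 1 ℕ.≤? V.lookup mf (k F.↑ʳ j))
  ...   | yes (j , 1≤) = zPoly k m j (P j) , leadMon (inj₂ j) , zPoly∈G j , generator-LM (inj₂ j) , unit-∣ₘ _ 1 mf 1≤
  ...   | no no-z = ⊥-elim (standard-not-leading f mf vanishes lm
                      (λ i → ℕP.≰⇒> (λ q≤ → no-x (i , q≤)))
                      (λ j → ℕP.n<1⇒n≡0 (ℕP.≰⇒> (λ 1≤ → no-z (j , 1≤)))))
module Correspondence {c} (K : Field c) (r : ℕ) (E : Fin (suc (suc r)) ↔ Field.Carrier K) (k m : ℕ) where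
  open Field K
  open Poly K
  open FiniteField K r E
  open Interpolation K r E using (reduced-exists)
  open Blocks {A = Carrier} k m
  open ≡-Reasoning

  Reduces : (Fin m → Vec Carrier k → Carrier) → (Fin m → Pol k) → Set c
  Reduces F P = ∀ j → DegLt q (P j) × Represents (P j) (F j)

  well-defined : ∀ F P → Reduces F P →
                 IsSystematicCode k m (ZeroSet (GSet k m q P))
                 × IsReducedGB (Vanishing (ZeroSet (GSet k m q P))) (GSet k m q P)
  well-defined F P reduces =
    GraphCode.systematic K r E k m F P reduces ,
    ( (λ g∈G y (y∈Z : ZeroSet (GSet k m q P) y) → y∈Z g∈G)
    , VanishingLeadingTerms.leading-divisible K r E k m F P reduces
    , LeadingMonomials.monic K r E k m F P reduces
    , LeadingMonomials.reduced K r E k m F P reduces )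

  -- the zero set determines the functions: it is their graph
  injective : ∀ F F′ P P′ → Reduces F P → Reduces F′ P′ →
              (∀ y → ZeroSet (GSet k m q P) y ⇔ ZeroSet (GSet k m q P′) y) → ∀ j x → F j x ≡ F′ j x
  injective F F′ P P′ reduces reduces′ same-zeros j x = begin
    F j x                                       ≡⟨ sym (Graph.lookup-graph x j) ⟩
    V.lookup (Graph.graph x) (k F.↑ʳ j)         ≡⟨ cong (λ y → V.lookup y (k F.↑ʳ j)) graph≡graph′ ⟩
    V.lookup (Graph′.graph x) (k F.↑ʳ j)        ≡⟨ Graph′.lookup-graph x j ⟩
    F′ j x                                      ∎
    where
    module Graph  = GraphCode K r E k m F P reduces
    module Graph′ = GraphCode K r E k m F′ P′ reduces′
    graph≡graph′ : Graph.graph x ≡ Graph′.graph x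
    graph≡graph′ = trans (Graph′.ZeroSet⇒graph _ (Equivalence.to (same-zeros _) (Graph.graph∈ZeroSet x)))
                         (cong Graph′.graph (low-++ x _))

  -- every systematic code is the graph of its redundancy functions
  surjective : ∀ (C : Vec Carrier (k ℕ.+ m) → Set c) → IsSystematicCode k m C →
               Σ[ F ∈ (Fin m → Vec Carrier k → Carrier) ] Σ[ P ∈ (Fin m → Pol k) ]
                 (Reduces F P × (∀ y → C y ⇔ ZeroSet (GSet k m q P) y))
  surjective C (φ , _ , systematic , image) = F , P , reduces , C⇔ZeroSet
    where
    F : Fin m → Vec Carrier k → Carrier
    F j v = V.lookup (φ v) (k F.↑ʳ j)
    P : Fin m → Pol k
    P j = proj₁ (reduced-exists (F j))
    reduces : Reduces F P
    reduces j = proj₂ (reduced-exists (F j))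
    open GraphCode K r E k m F P reduces using (graph; ZeroSet⇔graph)
    φ≡graph : ∀ v → φ v ≡ graph v
    φ≡graph v = begin
      φ v                    ≡⟨ sym (low-high (φ v)) ⟩
      low (φ v) V.++ high (φ v)
        ≡⟨ cong₂ V._++_ (systematic v) (lookup-extensional (high (φ v)) _ (λ j → trans (lookup-high (φ v) j) (sym (VP.lookup∘tabulate _ j)))) ⟩
      graph v                ∎
    C⇔ZeroSet : ∀ y → C y ⇔ ZeroSet (GSet k m q P) y
    C⇔ZeroSet y = mk⇔ to from
      where
      to : C y → ZeroSet (GSet k m q P) y
      to Cy with Equivalence.to (image y) Cy
      ... | v , φv≡y = Equivalence.from (ZeroSet⇔graph y) (v , trans (sym (φ≡graph v)) φv≡y)
      from : ZeroSet (GSet k m q P) y → C y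
      from y∈Z with Equivalence.to (ZeroSet⇔graph y) y∈Z
      ... | v , graph≡y = Equivalence.from (image y) (v , trans (φ≡graph v) graph≡y)

primePower≥2 : ∀ q → IsPrimePower q → ∃ λ r → q ≡ suc (suc r)
primePower≥2 q (zero , _ , p-prime , _) = ⊥-elim (¬prime[0] p-prime)
primePower≥2 q (suc zero , _ , p-prime , _) = ⊥-elim (¬prime[1] p-prime)
primePower≥2 q (suc (suc p′) , e , _ , refl) = q ℕ.∸ 2 , sym (ℕP.m+[n∸m]≡n 2≤q)
  where
  p = suc (suc p′)
  2≤q : 2 ≤ p ℕ.* p ℕ.^ e
  2≤q = ℕP.≤-trans (ℕ.s≤s (ℕ.s≤s ℕ.z≤n)) (ℕP.m≤m*n p (p ℕ.^ e) {{ℕ.>-nonZero (ℕP.m^n>0 p e)}})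

mainTheorem5 : ∀ {c} (K : Field c) (q : ℕ) → IsPrimePower q → HasSize K q →
  ∀ (k m : ℕ) → 1 ≤ k → 1 ≤ m →
  let open Field K
      open Poly K
  in
  -- every function K^k → K has a representing polynomial of degree < q in each variable
    (∀ (f : Vec Carrier k → Carrier) → ∃[ P ] (DegLt q P × Represents P f))
  -- and it is unique (as a polynomial, i.e. coefficientwise)
  × (∀ (P P′ : Pol k) (f : Vec Carrier k → Carrier) → DegLt q P → DegLt q P′ →
       Represents P f → Represents P′ f → ∀ e → coeff P e ≡ coeff P′ e)
  -- the map is well defined: G is the reduced lex Gröbner basis of the vanishing
  -- ideal of its zero set, which is a systematic (k+m,k,q) code
  × (∀ (F : Fin m → Vec Carrier k → Carrier) (P : Fin m → Pol k) →
       (∀ j → DegLt q (P j) × Represents (P j) (F j)) →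
       IsSystematicCode k m (ZeroSet (GSet k m q P))
       × IsReducedGB (Vanishing (ZeroSet (GSet k m q P))) (GSet k m q P))
  -- injectivity
  × (∀ (F F′ : Fin m → Vec Carrier k → Carrier) (P P′ : Fin m → Pol k) →
       (∀ j → DegLt q (P j) × Represents (P j) (F j)) →
       (∀ j → DegLt q (P′ j) × Represents (P′ j) (F′ j)) →
       (∀ y → ZeroSet (GSet k m q P) y ⇔ ZeroSet (GSet k m q P′) y) →
       ∀ j x → F j x ≡ F′ j x)
  -- surjectivity onto the class of systematic codes
  × (∀ (C : Vec Carrier (k Data.Nat.+ m) → Set c) → IsSystematicCode k m C →
       Σ[ F ∈ (Fin m → Vec Carrier k → Carrier) ] Σ[ P ∈ (Fin m → Pol k) ] ((∀ j → DegLt q (P j) × Represents (P j) (F j))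
                      × (∀ y → C y ⇔ ZeroSet (GSet k m q P) y)))
mainTheorem5 K q prime-power size k m _ _ with primePower≥2 q prime-power
... | r , refl =
    Interpolation.reduced-exists K r size
  , ReducedUniqueness.reduced-unique K r size
  , Correspondence.well-defined K r size k m
  , Correspondence.injective K r size k m
  , Correspondence.surjective K r size k m
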